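{- Let $n\geq 3$ and consider $S_n(T)$, for a 2-element set $T\subset S_3$, with the uniform probability measure. Let $\mathrm{LIS}_n(\sigma)$ and $\mathrm{LDS}_n(\sigma)$ denote the lengths of the longest increasing and longest decreasing subsequences of $\sigma$. Then: (a) For $T=\{132,321\}$, $\mathrm{LIS}_n$ has the same distribution as $D_n$, and $\mathrm{LDS}_n(\sigma)\leq 2$ for every $\sigma\in S_n(T)$. (b) For $T=\{132,231\}$, $\mathrm{LIS}_n$ and $\mathrm{LDS}_n$ both have the same distribution as $\mathrm{Bin}(n-1,1/2)+1$. (c) For $T=\{132,123\}$, $\mathrm{LDS}_n$ has the same distribution as $T_n$, and $\mathrm{LIS}_n(\sigma)\leq 2$ for every $\sigma\in S_n(T)$. (d) For $T=\{132,213\}$, $\mathrm{LDS}_n$ has the same distribution as $\mathrm{Bin}(n-1,1/2)+1$, and $\mathrm{LIS}_n$ has the same distribution as $R_{n-1}+1$.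
   Context: For a set $T$ of patterns, $S_n(T)$ is the set of permutations of $[n]=\{1,\dots,n\}$ that avoid (i.e., contain no subsequence order-isomorphic to) every pattern in $T$. $\mathrm{Bin}(m,p)$ denotes a binomial random variable. Let $\mathcal{D}[n]=\{(k,m)\in\mathbb{Z}^2:1\leq k<m\leq n\}\cup\{(0,0)\}$ with the uniform probability measure, and define $D_n((k,m))=n-\min(m-k,k)$. Let $X_1,X_2,\dots$ be independent random variables with $P(X_i=1)=P(X_i=0)=1/2$. Define $T_n=n-1-\sum_{i=2}^{n-2}X_i+\sum_{i=2}^{n-1}X_iX_{i-1}$, and let $R_m$ be the length of the longest run of zeros in $X_1,\dots,X_m$. -}

module Defs where

open import Data.Nat using (ℕ; zero; suc; _+_; _*_; _∸_; _⊔_; _⊓_; _<ᵇ_; _≡ᵇ_)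
open import Data.Bool using (Bool; true; false; not; _∧_; if_then_else_)
open import Data.List using (List; []; _∷_; _++_; map; length; concatMap; filterᵇ; upTo; inits; tails; foldr)
open import Data.Bool.ListAction using (any; all)
open import Data.Nat.ListAction using (sum)
open import Data.Product using (_×_; _,_)
open import Relation.Binary.PropositionalEquality using (_≡_)

count : {A : Set} → (A → Bool) → List A → ℕ
count p xs = length (filterᵇ p xs)

-- [a .. b] inclusive (empty when b < a)
fromTo : ℕ → ℕ → List ℕ
fromTo a b = map (a +_) (upTo (suc b ∸ a))

maximum : List ℕ → ℕ
maximum = foldr _⊔_ 0

subseqs : {A : Set} → List A → List (List A)
subseqs [] = [] ∷ []
subseqs (x ∷ xs) = map (x ∷_) (subseqs xs) ++ subseqs xs

segments : {A : Set} → List A → List (List A)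
segments xs = concatMap inits (tails xs)

-- Permutations (one-line notation σ(1) … σ(n))

words : ℕ → List ℕ → List (List ℕ)
words zero as = [] ∷ []
words (suc k) as = concatMap (λ a → map (a ∷_) (words k as)) as

distinct : List ℕ → Bool
distinct [] = true
distinct (x ∷ xs) = not (any (x ≡ᵇ_) xs) ∧ distinct xs

perms : ℕ → List (List ℕ)
perms n = filterᵇ distinct (words n (fromTo 1 n))

sig : List ℕ → List Bool
sig [] = []
sig (x ∷ xs) = map (x <ᵇ_) xs ++ sig xs

eqBools : List Bool → List Bool → Bool
eqBools [] [] = true
eqBools (true ∷ xs) (true ∷ ys) = eqBools xs ys
eqBools (false ∷ xs) (false ∷ ys) = eqBools xs ys
eqBools _ _ = false

orderIso : List ℕ → List ℕ → Bool
orderIso xs ys = (length xs ≡ᵇ length ys) ∧ eqBools (sig xs) (sig ys)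

contains : List ℕ → List ℕ → Bool
contains σ π = any (λ s → orderIso s π) (subseqs σ)

avoidsAll : List (List ℕ) → List ℕ → Bool
avoidsAll T σ = all (λ π → not (contains σ π)) T

Av : ℕ → List (List ℕ) → List (List ℕ)
Av n T = filterᵇ (avoidsAll T) (perms n)

increasing : List ℕ → Bool
increasing (x ∷ y ∷ xs) = (x <ᵇ y) ∧ increasing (y ∷ xs)
increasing _ = true

decreasing : List ℕ → Bool
decreasing (x ∷ y ∷ xs) = (y <ᵇ x) ∧ decreasing (y ∷ xs)
decreasing _ = true

LIS : List ℕ → ℕ
LIS σ = maximum (map length (filterᵇ increasing (subseqs σ)))

LDS : List ℕ → ℕ
LDS σ = maximum (map length (filterᵇ decreasing (subseqs σ)))

-- Equality in distribution of two random variables on finite uniform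
-- probability spaces Ω₁, Ω₂ (given as lists):
--   P(f = v) = P(g = v) for all v, i.e.
--   #{f = v}/|Ω₁| = #{g = v}/|Ω₂|, cross-multiplied.
SameDist : {A B : Set} → List A → (A → ℕ) → List B → (B → ℕ) → Set
SameDist Ω₁ f Ω₂ g = ∀ v →
  count (λ a → f a ≡ᵇ v) Ω₁ * length Ω₂ ≡ count (λ b → g b ≡ᵇ v) Ω₂ * length Ω₁

Dspace : ℕ → List (ℕ × ℕ)
Dspace n = (0 , 0) ∷ concatMap (λ m → map (λ k → (k , m)) (fromTo 1 (m ∸ 1))) (fromTo 2 n)

Dn : ℕ → ℕ × ℕ → ℕ
Dn n (k , m) = n ∸ ((m ∸ k) ⊓ k)

-- Fair coin flips: outcomes (X₁,…,X_m) ∈ {0,1}^m, uniformly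

bits : ℕ → List (List ℕ)
bits m = words m (0 ∷ 1 ∷ [])

-- X i for i ≥ 1 (X₁ is the head of the list); 0 outside the range
X : List ℕ → ℕ → ℕ
X [] i = 0
X (x ∷ xs) zero = 0
X (x ∷ xs) (suc zero) = x
X (x ∷ xs) (suc (suc i)) = X xs (suc i)

-- Bin(m,1/2) + 1 realised as 1 + X₁ + … + X_m on {0,1}^m
Bin+1 : List ℕ → ℕ
Bin+1 xs = suc (sum xs)

-- T_n = n - 1 - Σ_{i=2}^{n-2} X_i + Σ_{i=2}^{n-1} X_i X_{i-1}
-- (evaluated on (X₁,…,X_{n-1}); the ∸ is exact since Σ_{i=2}^{n-2} X_i ≤ n-1)
Tn : ℕ → List ℕ → ℕ
Tn n xs = (n ∸ 1 + sum (map (λ i → X xs i * X xs (i ∸ 1)) (fromTo 2 (n ∸ 1))))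
          ∸ sum (map (X xs) (fromTo 2 (n ∸ 2)))

R : List ℕ → ℕ
R xs = maximum (map length (filterᵇ (all (_≡ᵇ 0)) (segments xs)))

R+1 : List ℕ → ℕ
R+1 xs = suc (R xs)

p132 p321 p231 p123 p213 : List ℕ
p132 = 1 ∷ 3 ∷ 2 ∷ []
p321 = 3 ∷ 2 ∷ 1 ∷ []
p231 = 2 ∷ 3 ∷ 1 ∷ []
p123 = 1 ∷ 2 ∷ 3 ∷ []
p213 = 2 ∷ 1 ∷ 3 ∷ []

-- In a 132-avoiding permutation α n β, with n the maximum, every entry of α exceeds
-- every entry of β, and β is again 132-avoiding.  The second forbidden pattern pins
-- down α: for 231 one of α, β is empty; for 213 (resp. 123) α is an increasing (resp.
-- decreasing) run of consecutive values; for 321 either β is empty or α and β are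
-- increasing runs.  Recursing into β (or α) gives explicit bijections from binary
-- strings of length n - 1, resp. from 𝒟[n], onto S_n(T), and LIS and LDS of the
-- image are read off block by block: a block above the rest adds its length to a
-- chain that may continue into the rest, and competes with it otherwise.

module Submission where

open import Defs
open import Data.Bool using (Bool; true; false; T; T?)
open import Data.Bool.Properties using (T-∧)
open import Data.Bool.ListAction using (any; all)
open import Data.Empty using (⊥; ⊥-elim)
open import Data.Nat
open import Data.Nat.ListAction using (sum)
open import Data.Nat.Properties
open import Data.List using (List; []; _∷_; _++_; map; length; filterᵇ; concatMap; inits; cartesianProductWith; replicate; applyUpTo; module Inits)
open import Data.List.Properties using (length-map; length-++; map-∘; map-++; ++-identityʳ; ++-assoc; ∷-injective; ∷ʳ-injectiveˡ; length-replicate; filter-++)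
open import Data.List.Membership.Propositional using (_∈_; _∉_; find; lose)
open import Data.List.Membership.Propositional.Properties
  using (∈-map⁺; ∈-map⁻; ∈-++⁺ˡ; ∈-++⁺ʳ; ∈-++⁻; ∈-∃++; ∈-filter⁺; ∈-filter⁻; ∈-upTo⁺; ∈-upTo⁻; ∈-concatMap⁺; ∈-concatMap⁻)
open import Data.List.Membership.DecPropositional _≟_ using (_∈?_)
open import Data.List.Relation.Unary.Any using (here; there)
open import Data.List.Relation.Unary.Any.Properties using (any⁺; any⁻)
open import Data.List.Relation.Unary.All using (All; []; _∷_)
import Data.List.Relation.Unary.All as All
import Data.List.Relation.Unary.All.Properties as All
open import Data.List.Relation.Unary.AllPairs using (AllPairs; []; _∷_)
import Data.List.Relation.Unary.AllPairs as AllPairs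
import Data.List.Relation.Unary.AllPairs.Properties as AllPairs
open import Data.List.Relation.Unary.Unique.Propositional using (Unique)
import Data.List.Relation.Unary.Unique.Propositional.Properties as Unique
open import Data.List.Relation.Binary.Disjoint.Propositional using (Disjoint)
open import Data.List.Relation.Binary.Sublist.Propositional using (_⊆_; []; _∷_; _∷ʳ_; ⊆-refl; ⊆-trans; minimum; from∈)
import Data.List.Relation.Binary.Sublist.Propositional.Properties as Sublist
open import Data.List.Relation.Binary.Permutation.Propositional using (_↭_; ↭-trans; ↭-reflexive)
import Data.List.Relation.Binary.Permutation.Propositional.Properties as Perm
open import Data.List.Relation.Binary.BagAndSetEquality using (∼bag⇒↭)
open import Data.List.Membership.Propositional.Properties.WithK using (unique∧set⇒bag)
open import Data.Product using (∃₂; ∃-syntax; _×_; _,_; proj₁; proj₂)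
open import Data.Sum using (_⊎_; inj₁; inj₂)
open import Function using (_∘_; _$_; _⇔_; mk⇔; Equivalence)
open import Data.Nat.Induction using (<-rec)
open import Relation.Nullary using (¬_; yes; no; contradiction)
open import Relation.Binary.PropositionalEquality

open import Algebra.Properties.CommutativeSemigroup +-commutativeSemigroup using () renaming (x∙yz≈y∙xz to +-left-comm)

count-map : ∀ {A : Set} (f : A → ℕ) v (xs : List A) →
            count (λ a → f a ≡ᵇ v) xs ≡ count (_≡ᵇ v) (map f xs)
count-map f v [] = refl
count-map f v (x ∷ xs) with f x ≡ᵇ v
... | true  = cong suc (count-map f v xs)
... | false = count-map f v xs

count-↭ : (p : ℕ → Bool) {xs ys : List ℕ} → xs ↭ ys → count p xs ≡ count p ys
count-↭ p xs↭ys = Perm.↭-length (Perm.filter-↭ (T? ∘ p) xs↭ys)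

sameDist-↭ : ∀ {A B : Set} {Ω₁ : List A} {Ω₂ : List B} (f : A → ℕ) (g : B → ℕ) →
             map f Ω₁ ↭ map g Ω₂ → SameDist Ω₁ f Ω₂ g
sameDist-↭ {Ω₁ = Ω₁} {Ω₂} f g fΩ₁↭gΩ₂ v = cong₂ _*_ counts (sym sizes)
  where
  counts = trans (count-map f v Ω₁) (trans (count-↭ (_≡ᵇ v) fΩ₁↭gΩ₂) (sym (count-map g v Ω₂)))
  sizes  = trans (sym (length-map f Ω₁)) (trans (Perm.↭-length fΩ₁↭gΩ₂) (length-map g Ω₂))

map-↭-transport : ∀ {A : Set} {Ω : List (List ℕ)} {P : List A} {φ : A → List ℕ} (f : List ℕ → ℕ) (g : A → ℕ) →
                  Ω ↭ map φ P → (∀ {a} → a ∈ P → f (φ a) ≡ g a) → map f Ω ↭ map g P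
map-↭-transport {P = P} {φ} f g Ω↭φP fφ≡g =
  ↭-trans (Perm.map⁺ f Ω↭φP) (↭-reflexive (trans (sym (map-∘ P)) (map-cong-∈ P fφ≡g)))
  where
  map-cong-∈ : ∀ xs → (∀ {a} → a ∈ xs → f (φ a) ≡ g a) → map (f ∘ φ) xs ≡ map g xs
  map-cong-∈ [] _ = refl
  map-cong-∈ (x ∷ xs) h = cong₂ _∷_ (h (here refl)) (map-cong-∈ xs (h ∘ there))

Unique⇒↭ : ∀ {A : Set} {xs ys : List A} → Unique xs → Unique ys →
           (∀ {z} → z ∈ xs → z ∈ ys) → (∀ {z} → z ∈ ys → z ∈ xs) → xs ↭ ys
Unique⇒↭ ux uy to from = ∼bag⇒↭ (unique∧set⇒bag ux uy (mk⇔ to from))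

Unique-map⁺-injectiveOn : ∀ {A B : Set} (f : A → B) {xs : List A} →
  (∀ {x y} → x ∈ xs → y ∈ xs → f x ≡ f y → x ≡ y) → Unique xs → Unique (map f xs)
Unique-map⁺-injectiveOn f inj [] = []
Unique-map⁺-injectiveOn f {x ∷ xs} inj (x∉xs ∷ u) =
  All.tabulate fx≢ ∷ Unique-map⁺-injectiveOn f (λ p q → inj (there p) (there q)) u
  where
  fx≢ : ∀ {z} → z ∈ map f xs → f x ≢ z
  fx≢ z∈ fx≡z with ∈-map⁻ f z∈
  ... | y , y∈ , refl = All.lookup x∉xs y∈ (inj (here refl) (there y∈) fx≡z)

map-involution-↭ : ∀ {A : Set} (f : A → A) {xs : List A} → Unique xs →
                   (∀ {x} → x ∈ xs → f x ∈ xs) → (∀ {x} → x ∈ xs → f (f x) ≡ x) → map f xs ↭ xs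
map-involution-↭ f u closed invol =
  Unique⇒↭ (Unique-map⁺-injectiveOn f (λ x∈ y∈ fx≡fy → trans (sym (invol x∈)) (trans (cong f fx≡fy) (invol y∈))) u)
           u to from
  where
  to : ∀ {z} → z ∈ map f _ → z ∈ _
  to z∈ with ∈-map⁻ f z∈
  ... | x , x∈ , refl = closed x∈
  from : ∀ {z} → z ∈ _ → z ∈ map f _
  from z∈ = subst (_∈ map f _) (invol z∈) (∈-map⁺ f (closed z∈))

_≺[_]_ : ℕ → Bool → ℕ → Set
a ≺[ true ]  b = a < b
a ≺[ false ] b = b ≤ a

<ᵇ-≺ : ∀ a b → a ≺[ a <ᵇ b ] b
<ᵇ-≺ a b with a <ᵇ b in eq
... | true  = <ᵇ⇒< a b (subst T (sym eq) _)
... | false = ≮⇒≥ (λ a<b → subst T eq (<⇒<ᵇ a<b))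

≺⇒<ᵇ≡ : ∀ {a b} x → a ≺[ x ] b → (a <ᵇ b) ≡ x
≺⇒<ᵇ≡ {a} {b} x a≺b with a <ᵇ b | <ᵇ-≺ a b
≺⇒<ᵇ≡ true  a<b | true  | _   = refl
≺⇒<ᵇ≡ true  a<b | false | b≤a = contradiction a<b (≤⇒≯ b≤a)
≺⇒<ᵇ≡ false b≤a | true  | a<b = contradiction a<b (≤⇒≯ b≤a)
≺⇒<ᵇ≡ false b≤a | false | _   = refl

⊆-++⁻ : ∀ {s : List ℕ} ys {vs} → s ⊆ ys ++ vs → ∃₂ λ s₁ s₂ → s ≡ s₁ ++ s₂ × s₁ ⊆ ys × s₂ ⊆ vs
⊆-++⁻ [] p = [] , _ , refl , [] , p
⊆-++⁻ (y ∷ ys) (.y ∷ʳ p) with ⊆-++⁻ ys p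
... | s₁ , s₂ , refl , p₁ , p₂ = s₁ , s₂ , refl , y ∷ʳ p₁ , p₂
⊆-++⁻ (y ∷ ys) (refl ∷ p) with ⊆-++⁻ ys p
... | s₁ , s₂ , refl , p₁ , p₂ = y ∷ s₁ , s₂ , refl , refl ∷ p₁ , p₂

⊆-insert : ∀ α {m : ℕ} {β} → α ++ β ⊆ α ++ m ∷ β
⊆-insert α {m} = Sublist.++⁺ (⊆-refl {x = α}) (m ∷ʳ ⊆-refl)

⊆⇒∈-subseqs : ∀ {A : Set} {s σ : List A} → s ⊆ σ → s ∈ subseqs σ
⊆⇒∈-subseqs [] = here refl
⊆⇒∈-subseqs {σ = x ∷ σ} (.x ∷ʳ p) = ∈-++⁺ʳ _ (⊆⇒∈-subseqs p)
⊆⇒∈-subseqs (refl ∷ p) = ∈-++⁺ˡ (∈-map⁺ _ (⊆⇒∈-subseqs p))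

∈-subseqs⇒⊆ : ∀ {A : Set} {s : List A} σ → s ∈ subseqs σ → s ⊆ σ
∈-subseqs⇒⊆ [] (here refl) = []
∈-subseqs⇒⊆ (x ∷ σ) s∈ with ∈-++⁻ (map (x ∷_) (subseqs σ)) s∈
... | inj₂ s∈′ = x ∷ʳ ∈-subseqs⇒⊆ σ s∈′
... | inj₁ s∈′ with ∈-map⁻ (x ∷_) s∈′
...   | _ , s∈″ , refl = refl ∷ ∈-subseqs⇒⊆ σ s∈″

AllPairs-resp-⊇ : ∀ {R : ℕ → ℕ → Set} {xs ys} → xs ⊆ ys → AllPairs R ys → AllPairs R xs
AllPairs-resp-⊇ [] _ = []
AllPairs-resp-⊇ (_ ∷ʳ p) (_ ∷ r) = AllPairs-resp-⊇ p r
AllPairs-resp-⊇ (refl ∷ p) (h ∷ r) = Sublist.All-resp-⊆ p h ∷ AllPairs-resp-⊇ p r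

AllPairs-++⁻ : ∀ {R : ℕ → ℕ → Set} xs {ys} → AllPairs R (xs ++ ys) →
               AllPairs R xs × AllPairs R ys × All (λ x → All (R x) ys) xs
AllPairs-++⁻ [] r = [] , r , []
AllPairs-++⁻ (x ∷ xs) (h ∷ r) with AllPairs-++⁻ xs r
... | rxs , rys , cross = All.++⁻ˡ xs h ∷ rxs , rys , All.++⁻ʳ xs h ∷ cross

All-pair : ∀ {P : ℕ → Set} {τ b c} → All P τ → (b ∷ c ∷ []) ⊆ τ → P b × P c
All-pair all sub with Sublist.All-resp-⊆ sub all
... | pb ∷ pc ∷ [] = pb , pc

⊆-∈ : ∀ {xs ys} {x : ℕ} → xs ⊆ ys → x ∈ xs → x ∈ ys
⊆-∈ = Sublist.Any-resp-⊆

data TripleView (α : List ℕ) (m : ℕ) (β : List ℕ) : ℕ → ℕ → ℕ → Set where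
  unused : ∀ {a b c} → (a ∷ b ∷ c ∷ []) ⊆ α ++ β → TripleView α m β a b c
  first  : ∀ {b c} → (b ∷ c ∷ []) ⊆ β → TripleView α m β m b c
  middle : ∀ {a c} → a ∈ α → c ∈ β → TripleView α m β a m c
  last   : ∀ {a b} → (a ∷ b ∷ []) ⊆ α → TripleView α m β a b m

tripleView : ∀ α {m : ℕ} {β a b c} → (a ∷ b ∷ c ∷ []) ⊆ α ++ m ∷ β → TripleView α m β a b c
tripleView α sub with ⊆-++⁻ α sub
... | s₁ , s₂ , eq , p₁ , _ ∷ʳ p₂ = unused (subst (_⊆ α ++ _) (sym eq) (Sublist.++⁺ p₁ p₂))
... | [] , _ ∷ _ , refl , p₁ , refl ∷ p₂ = first p₂
... | _ ∷ [] , _ ∷ _ ∷ [] , refl , p₁ , refl ∷ p₂ = middle (⊆-∈ p₁ (here refl)) (⊆-∈ p₂ (here refl))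
... | _ ∷ _ ∷ [] , _ ∷ [] , refl , p₁ , refl ∷ p₂ = last p₁
... | _ ∷ _ ∷ _ ∷ [] , _ ∷ _ , () , _ , refl ∷ _
... | _ ∷ _ ∷ _ ∷ _ ∷ _ , _ ∷ _ , () , _ , refl ∷ _

data TripleIn++ (A B : List ℕ) (x y z : ℕ) : Set where
  left   : (x ∷ y ∷ z ∷ []) ⊆ A → TripleIn++ A B x y z
  left₂  : (x ∷ y ∷ []) ⊆ A → z ∈ B → TripleIn++ A B x y z
  left₁  : x ∈ A → (y ∷ z ∷ []) ⊆ B → TripleIn++ A B x y z
  right  : (x ∷ y ∷ z ∷ []) ⊆ B → TripleIn++ A B x y z

tripleIn++ : ∀ A {B : List ℕ} {x y z} → (x ∷ y ∷ z ∷ []) ⊆ A ++ B → TripleIn++ A B x y z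
tripleIn++ A sub with ⊆-++⁻ A sub
... | [] , _ , refl , _ , sub₂ = right sub₂
... | _ ∷ [] , _ , refl , sub₁ , sub₂ = left₁ (⊆-∈ sub₁ (here refl)) sub₂
... | _ ∷ _ ∷ [] , _ , refl , sub₁ , sub₂ = left₂ sub₁ (⊆-∈ sub₂ (here refl))
... | _ ∷ _ ∷ _ ∷ [] , _ , refl , sub₁ , _ = left sub₁
... | _ ∷ _ ∷ _ ∷ _ ∷ _ , _ , () , _ , _

AllPairs-pair : ∀ {R : ℕ → ℕ → Set} {x y γ} → (x ∷ y ∷ []) ⊆ γ → AllPairs R γ → R x y
AllPairs-pair sub chain with AllPairs-resp-⊇ sub chain
... | (rxy ∷ []) ∷ _ = rxy

pairs⇒AllPairs : ∀ {R : ℕ → ℕ → Set} xs → (∀ {x y} → (x ∷ y ∷ []) ⊆ xs → R x y) → AllPairs R xs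
pairs⇒AllPairs [] _ = []
pairs⇒AllPairs (x ∷ xs) r = All.tabulate (λ y∈ → r (refl ∷ from∈ y∈)) ∷ pairs⇒AllPairs xs (λ sub → r (x ∷ʳ sub))

Unique-++⇒≢ : ∀ α {β : List ℕ} {a c} → Unique (α ++ β) → a ∈ α → c ∈ β → a ≢ c
Unique-++⇒≢ α u a∈ c∈ = All.lookup (All.lookup (proj₂ (proj₂ (AllPairs-++⁻ α u))) a∈) c∈

-- Shape (sig p) a b c: the triple a b c is order-isomorphic to the triple p
-- (with ties allowed, exactly as recorded by sig).
Shape : List Bool → ℕ → ℕ → ℕ → Set
Shape (x ∷ y ∷ z ∷ []) a b c = a ≺[ x ] b × a ≺[ y ] c × b ≺[ z ] c
Shape _                a b c = ⊥

Contains : List ℕ → List ℕ → Set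
Contains p σ = ∃[ a ] ∃[ b ] ∃[ c ] ((a ∷ b ∷ c ∷ []) ⊆ σ × Shape (sig p) a b c)

Avoids : List ℕ → List ℕ → Set
Avoids p σ = ¬ Contains p σ

Avoids₂ : List ℕ → List ℕ → List ℕ → Set
Avoids₂ p q σ = Avoids p σ × Avoids q σ

Shape-sig : ∀ a b c → Shape (sig (a ∷ b ∷ c ∷ [])) a b c
Shape-sig a b c = <ᵇ-≺ a b , <ᵇ-≺ a c , <ᵇ-≺ b c

Shape⇒sig≡ : ∀ {a b c} x y z → Shape (x ∷ y ∷ z ∷ []) a b c → sig (a ∷ b ∷ c ∷ []) ≡ x ∷ y ∷ z ∷ []
Shape⇒sig≡ x y z (ab , ac , bc) =
  cong₂ _∷_ (≺⇒<ᵇ≡ x ab) (cong₂ _∷_ (≺⇒<ᵇ≡ y ac) (cong (_∷ []) (≺⇒<ᵇ≡ z bc)))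

eqBools⇒≡ : ∀ xs ys → T (eqBools xs ys) → xs ≡ ys
eqBools⇒≡ [] [] _ = refl
eqBools⇒≡ (true ∷ xs) (true ∷ ys) t = cong (true ∷_) (eqBools⇒≡ xs ys t)
eqBools⇒≡ (false ∷ xs) (false ∷ ys) t = cong (false ∷_) (eqBools⇒≡ xs ys t)

eqBools-refl : ∀ xs → T (eqBools xs xs)
eqBools-refl [] = _
eqBools-refl (true ∷ xs) = eqBools-refl xs
eqBools-refl (false ∷ xs) = eqBools-refl xs

module _ (x y z : ℕ) where

  orderIso⇒Shape : ∀ s → T (orderIso s (x ∷ y ∷ z ∷ [])) → ∃[ a ] ∃[ b ] ∃[ c ] (s ≡ a ∷ b ∷ c ∷ [] × Shape (sig (x ∷ y ∷ z ∷ [])) a b c)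
  orderIso⇒Shape (a ∷ b ∷ c ∷ []) t =
    a , b , c , refl , subst (λ bs → Shape bs a b c) (eqBools⇒≡ _ _ t) (Shape-sig a b c)

  contains⇒Contains : ∀ σ → T (contains σ (x ∷ y ∷ z ∷ [])) → Contains (x ∷ y ∷ z ∷ []) σ
  contains⇒Contains σ t with find (any⁻ _ (subseqs σ) t)
  ... | s , s∈ , iso with orderIso⇒Shape s iso
  ...   | a , b , c , refl , shape = a , b , c , ∈-subseqs⇒⊆ σ s∈ , shape

  Contains⇒contains : ∀ σ → Contains (x ∷ y ∷ z ∷ []) σ → T (contains σ (x ∷ y ∷ z ∷ []))
  Contains⇒contains σ (a , b , c , sub , shape) = any⁺ _ (lose (⊆⇒∈-subseqs sub) iso)
    where
    iso : T (orderIso (a ∷ b ∷ c ∷ []) (x ∷ y ∷ z ∷ []))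
    iso = subst (λ bs → T (eqBools bs (sig (x ∷ y ∷ z ∷ []))))
                (sym (Shape⇒sig≡ (x <ᵇ y) (x <ᵇ z) (y <ᵇ z) shape)) (eqBools-refl (sig (x ∷ y ∷ z ∷ [])))

Contains-mono : ∀ {p τ σ : List ℕ} → τ ⊆ σ → Contains p τ → Contains p σ
Contains-mono τ⊆σ (a , b , c , sub , shape) = a , b , c , ⊆-trans sub τ⊆σ , shape

Avoids-anti : ∀ {p τ σ : List ℕ} → τ ⊆ σ → Avoids p σ → Avoids p τ
Avoids-anti {p} τ⊆σ avoid c = avoid (Contains-mono {p} τ⊆σ c)

Avoids-∷ : ∀ {p : List ℕ} {m : ℕ} {τ : List ℕ} → Avoids p τ → (∀ {b c} → (b ∷ c ∷ []) ⊆ τ → ¬ Shape (sig p) m b c) →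
           Avoids p (m ∷ τ)
Avoids-∷ avoid new (a , b , c , sub , shape) with tripleView [] sub
... | unused sub′ = avoid (a , b , c , sub′ , shape)
... | first sub′  = new sub′ shape

Avoids-∷ʳ : ∀ {p : List ℕ} {m : ℕ} {τ : List ℕ} → Avoids p τ → (∀ {a b} → (a ∷ b ∷ []) ⊆ τ → ¬ Shape (sig p) a b m) →
            Avoids p (τ ++ m ∷ [])
Avoids-∷ʳ {τ = τ} avoid new (a , b , c , sub , shape) with tripleView τ sub
... | unused sub′ = avoid (a , b , c , subst ((a ∷ b ∷ c ∷ []) ⊆_) (++-identityʳ τ) sub′ , shape)
... | last sub′   = new sub′ shape

Avoids-[] : ∀ {p} → Avoids p []
Avoids-[] (_ , _ , _ , () , _)

Avoids-[x] : ∀ {p x} → Avoids p (x ∷ [])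
Avoids-[x] (_ , _ , _ , sub , _) with Sublist.length-mono-≤ sub
... | s≤s ()

avoidsAll₂⇔ : ∀ σ p q → T (avoidsAll (p ∷ q ∷ []) σ) ⇔ (¬ T (contains σ p) × ¬ T (contains σ q))
avoidsAll₂⇔ σ p q with contains σ p | contains σ q
... | false | false = mk⇔ (λ _ → (λ ()) , (λ ())) (λ _ → _)
... | true  | _     = mk⇔ (λ ()) (λ (¬c , _) → ¬c _)
... | false | true  = mk⇔ (λ ()) (λ (_ , ¬c) → ¬c _)

concatMap-prepend : ∀ (as : List ℕ) (W : List (List ℕ)) → concatMap (λ a → map (a ∷_) W) as ≡ cartesianProductWith _∷_ as W
concatMap-prepend [] W = refl
concatMap-prepend (a ∷ as) W = cong (map (a ∷_) W ++_) (concatMap-prepend as W)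

∈-words⁻ : ∀ k {as σ : List ℕ} → σ ∈ words k as → length σ ≡ k × All (_∈ as) σ
∈-words⁻ zero (here refl) = refl , []
∈-words⁻ (suc k) {as} σ∈ with find (∈-concatMap⁻ (λ a → map (a ∷_) (words k as)) {xs = as} σ∈)
... | a , a∈ , σ∈′ with ∈-map⁻ (a ∷_) σ∈′
...   | τ , τ∈ , refl with ∈-words⁻ k τ∈
...     | len , all = cong suc len , a∈ ∷ all

∈-words⁺ : ∀ {as : List ℕ} σ → All (_∈ as) σ → σ ∈ words (length σ) as
∈-words⁺ [] [] = here refl
∈-words⁺ {as} (x ∷ σ) (x∈ ∷ all) =
  ∈-concatMap⁺ (λ a → map (a ∷_) (words (length σ) as)) (lose x∈ (∈-map⁺ (x ∷_) (∈-words⁺ σ all)))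

Unique-words : ∀ k {as : List ℕ} → Unique as → Unique (words k as)
Unique-words zero u = [] ∷ []
Unique-words (suc k) {as} u =
  subst Unique (sym (concatMap-prepend as (words k as))) (Unique.cartesianProductWith⁺ _∷_ ∷-injective u (Unique-words k u))

∈-fromTo⁻ : ∀ a b {x} → x ∈ fromTo a b → a ≤ x × x ≤ b
∈-fromTo⁻ a b x∈ with ∈-map⁻ (a +_) x∈
... | i , i∈ , refl = m≤m+n a i , ≤-pred (subst (_≤ suc b) (cong suc (+-comm i a)) (m≤o∸n⇒m+n≤o (suc i) a≤1+b i<))
  where
  i< = ∈-upTo⁻ i∈
  a≤1+b = <⇒≤ (m∸n≢0⇒n<m (λ e → n≮0 (subst (i <_) e i<)))

∈-fromTo⁺ : ∀ a b {x} → a ≤ x → x ≤ b → x ∈ fromTo a b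
∈-fromTo⁺ a b a≤x x≤b =
  subst (_∈ fromTo a b) (m+[n∸m]≡n a≤x) (∈-map⁺ (a +_) (∈-upTo⁺ (∸-monoˡ-< (s≤s x≤b) a≤x)))

Unique-fromTo : ∀ a b → Unique (fromTo a b)
Unique-fromTo a b = Unique.map⁺ (+-cancelˡ-≡ a _ _) (Unique.upTo⁺ _)

distinct⇒Unique : ∀ xs → T (distinct xs) → Unique xs
distinct⇒Unique [] _ = []
distinct⇒Unique (x ∷ xs) t with any (x ≡ᵇ_) xs in x∈?
... | false = All.tabulate x≢ ∷ distinct⇒Unique xs t
  where
  x≢ : ∀ {y} → y ∈ xs → x ≢ y
  x≢ y∈ refl = subst T x∈? (any⁺ _ (lose y∈ (≡⇒≡ᵇ x x refl)))

Unique⇒distinct : ∀ xs → Unique xs → T (distinct xs)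
Unique⇒distinct [] _ = _
Unique⇒distinct (x ∷ xs) (x∉ ∷ u) with any (x ≡ᵇ_) xs in x∈?
... | false = Unique⇒distinct xs u
... | true with find (any⁻ _ xs (subst T (sym x∈?) _))
...   | y , y∈ , x≡ᵇy = All.lookup x∉ y∈ (≡ᵇ⇒≡ x y x≡ᵇy)

Between : ℕ → ℕ → ℕ → Set
Between lo hi x = lo < x × x ≤ hi

InRange : ℕ → ℕ → Set
InRange n = Between 0 n

record IsPerm (n : ℕ) (σ : List ℕ) : Set where
  constructor isPerm
  field
    length≡ : length σ ≡ n
    inRange : All (InRange n) σ
    unique  : Unique σ

open IsPerm

∈-perms⁻ : ∀ n {σ} → σ ∈ perms n → IsPerm n σ
∈-perms⁻ n {σ} σ∈ with ∈-filter⁻ (T? ∘ distinct) {xs = words n (fromTo 1 n)} σ∈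
... | σ∈′ , dist with ∈-words⁻ n σ∈′
...   | len , all = isPerm len (All.map (∈-fromTo⁻ 1 n) all) (distinct⇒Unique σ dist)

∈-perms⁺ : ∀ n {σ} → IsPerm n σ → σ ∈ perms n
∈-perms⁺ n {σ} (isPerm refl inR u) =
  ∈-filter⁺ (T? ∘ distinct) (∈-words⁺ σ (All.map (λ (lo , hi) → ∈-fromTo⁺ 1 n lo hi) inR)) (Unique⇒distinct σ u)

Unique-perms : ∀ n → Unique (perms n)
Unique-perms n = Unique.filter⁺ (T? ∘ distinct) (Unique-words n (Unique-fromTo 1 n))

module _ {x y z u v w : ℕ} where

  ∈-Av⁻ : ∀ n {σ} → σ ∈ Av n ((x ∷ y ∷ z ∷ []) ∷ (u ∷ v ∷ w ∷ []) ∷ []) →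
          IsPerm n σ × Avoids₂ (x ∷ y ∷ z ∷ []) (u ∷ v ∷ w ∷ []) σ
  ∈-Av⁻ n {σ} σ∈ with ∈-filter⁻ (T? ∘ avoidsAll ((x ∷ y ∷ z ∷ []) ∷ (u ∷ v ∷ w ∷ []) ∷ [])) {xs = perms n} σ∈
  ... | σ∈′ , avoid with Equivalence.to (avoidsAll₂⇔ σ (x ∷ y ∷ z ∷ []) (u ∷ v ∷ w ∷ [])) avoid
  ...   | ¬c₁ , ¬c₂ = ∈-perms⁻ n σ∈′ , ¬c₁ ∘ Contains⇒contains x y z σ , ¬c₂ ∘ Contains⇒contains u v w σ

  ∈-Av⁺ : ∀ n {σ} → IsPerm n σ → Avoids₂ (x ∷ y ∷ z ∷ []) (u ∷ v ∷ w ∷ []) σ →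
          σ ∈ Av n ((x ∷ y ∷ z ∷ []) ∷ (u ∷ v ∷ w ∷ []) ∷ [])
  ∈-Av⁺ n {σ} perm (¬C₁ , ¬C₂) =
    ∈-filter⁺ (T? ∘ avoidsAll ((x ∷ y ∷ z ∷ []) ∷ (u ∷ v ∷ w ∷ []) ∷ [])) (∈-perms⁺ n perm)
      (Equivalence.from (avoidsAll₂⇔ σ (x ∷ y ∷ z ∷ []) (u ∷ v ∷ w ∷ [])) (¬C₁ ∘ contains⇒Contains x y z σ , ¬C₂ ∘ contains⇒Contains u v w σ))

  Unique-Av : ∀ n → Unique (Av n ((x ∷ y ∷ z ∷ []) ∷ (u ∷ v ∷ w ∷ []) ∷ []))
  Unique-Av n = Unique.filter⁺ (T? ∘ avoidsAll ((x ∷ y ∷ z ∷ []) ∷ (u ∷ v ∷ w ∷ []) ∷ [])) (Unique-perms n)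

record Encoding {A : Set} (n : ℕ) (p q : List ℕ) (P : List A) (φ : A → List ℕ) : Set where
  field
    sound     : ∀ {a} → a ∈ P → IsPerm n (φ a) × Avoids₂ p q (φ a)
    complete  : ∀ {σ} → IsPerm n σ → Avoids₂ p q σ → ∃[ a ] (a ∈ P × σ ≡ φ a)
    injective : ∀ {a b} → a ∈ P → b ∈ P → φ a ≡ φ b → a ≡ b

Encoding⇒↭ : ∀ {A : Set} {n x y z u v w} {P : List A} {φ : A → List ℕ} → Unique P →
             Encoding n (x ∷ y ∷ z ∷ []) (u ∷ v ∷ w ∷ []) P φ →
             Av n ((x ∷ y ∷ z ∷ []) ∷ (u ∷ v ∷ w ∷ []) ∷ []) ↭ map φ P
Encoding⇒↭ {n = n} {x} {y} {z} {u} {v} {w} {P} {φ} uP enc =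
  Unique⇒↭ (Unique-Av {x} {y} {z} {u} {v} {w} n) (Unique-map⁺-injectiveOn φ injective uP) to from
  where
  open Encoding enc
  to : ∀ {σ} → σ ∈ Av n ((x ∷ y ∷ z ∷ []) ∷ (u ∷ v ∷ w ∷ []) ∷ []) → σ ∈ map φ P
  to σ∈ with ∈-Av⁻ {x} {y} {z} {u} {v} {w} n σ∈
  ... | perm , avoid with complete perm avoid
  ...   | a , a∈ , refl = ∈-map⁺ φ a∈
  from : ∀ {σ} → σ ∈ map φ P → σ ∈ Av n ((x ∷ y ∷ z ∷ []) ∷ (u ∷ v ∷ w ∷ []) ∷ [])
  from σ∈ with ∈-map⁻ φ σ∈
  ... | a , a∈ , refl = ∈-Av⁺ {x} {y} {z} {u} {v} {w} n (proj₁ (sound a∈)) (proj₂ (sound a∈))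

length-insert : ∀ α {m : ℕ} {β} → length (α ++ m ∷ β) ≡ suc (length (α ++ β))
length-insert [] = refl
length-insert (x ∷ α) = cong suc (length-insert α)

All-insert⁺ : ∀ {P : ℕ → Set} α {m β} → All P (α ++ β) → P m → All P (α ++ m ∷ β)
All-insert⁺ α all pm = All.++⁺ (All.++⁻ˡ α all) (pm ∷ All.++⁻ʳ α all)

Unique-insert⁻ : ∀ α {m : ℕ} {β} → Unique (α ++ m ∷ β) → All (_≢ m) (α ++ β)
Unique-insert⁻ [] (m∉ ∷ _) = All.map (λ m≢y y≡m → m≢y (sym y≡m)) m∉
Unique-insert⁻ (a ∷ α) (a∉ ∷ u) = All.lookup a∉ (∈-++⁺ʳ α (here refl)) ∷ Unique-insert⁻ α u

Unique-insert⁺ : ∀ α {m : ℕ} {β} → Unique (α ++ β) → All (_≢ m) (α ++ β) → Unique (α ++ m ∷ β)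
Unique-insert⁺ [] u ≢m = All.map (λ y≢m m≡y → y≢m (sym m≡y)) ≢m ∷ u
Unique-insert⁺ (a ∷ α) (a∉ ∷ u) (a≢m ∷ ≢m) = All-insert⁺ α a∉ a≢m ∷ Unique-insert⁺ α u ≢m

∉⇒All≢ : ∀ {m : ℕ} {xs} → m ∉ xs → All (_≢ m) xs
∉⇒All≢ {xs = xs} m∉ = All.tabulate (λ x∈ x≡m → m∉ (subst (_∈ xs) x≡m x∈))

Between-lower : ∀ {lo h xs} → All (Between lo (suc h)) xs → All (_≢ suc h) xs → All (Between lo h) xs
Between-lower inR ≢h = All.zipWith (λ ((lo<x , x≤) , x≢) → lo<x , ≤-pred (≤∧≢⇒< x≤ x≢)) (inR , ≢h)

Between-remove : ∀ {lo h} α {β} → All (Between lo (suc h)) (α ++ suc h ∷ β) → Unique (α ++ suc h ∷ β) →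
                 All (Between lo h) (α ++ β)
Between-remove α inR u = Between-lower (Sublist.All-resp-⊆ (⊆-insert α) inR) (Unique-insert⁻ α u)

Unique-Between⇒length≤ : ∀ {lo} hi {xs} → lo ≤ hi → All (Between lo hi) xs → Unique xs → length xs + lo ≤ hi
Unique-Between⇒length≤ hi lo≤hi [] _ = lo≤hi
Unique-Between⇒length≤ zero _ ((lo<x , x≤0) ∷ _) _ = contradiction (<-≤-trans lo<x x≤0) n≮0
Unique-Between⇒length≤ (suc h) {xs} lo≤ inR u with suc h ∈? xs
... | no h∉ with Between-lower inR (∉⇒All≢ h∉)
...   | [] = lo≤
...   | inR′@((lo<x , x≤h) ∷ _) = m≤n⇒m≤1+n (Unique-Between⇒length≤ h (<⇒≤ (<-≤-trans lo<x x≤h)) inR′ u)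
Unique-Between⇒length≤ (suc h) lo≤ inR u | yes h∈ with ∈-∃++ h∈
... | α , β , refl =
  subst (_≤ suc h) (cong (_+ _) (sym (length-insert α)))
    (s≤s (Unique-Between⇒length≤ h (≤-pred (proj₁ (All.lookup inR h∈))) (Between-remove α inR u)
                                  (AllPairs-resp-⊇ (⊆-insert α) u)))

IsPerm-remove-max : ∀ {n} α {β} → IsPerm (suc n) (α ++ suc n ∷ β) → IsPerm n (α ++ β)
IsPerm-remove-max α (isPerm len inR u) =
  isPerm (suc-injective (trans (sym (length-insert α)) len)) (Between-remove α inR u) (AllPairs-resp-⊇ (⊆-insert α) u)

IsPerm⇒max∈ : ∀ {n σ} → IsPerm (suc n) σ → suc n ∈ σ
IsPerm⇒max∈ {n} {σ} (isPerm len inR u) with suc n ∈? σ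
... | yes n∈ = n∈
... | no n∉ = contradiction (Unique-Between⇒length≤ n z≤n (Between-lower inR (∉⇒All≢ n∉)) u)
                            (subst (λ k → k + 0 ≰ n) (sym len) (subst (_≰ n) (sym (+-identityʳ _)) (n≮n n)))

IsPerm-split-max : ∀ {n σ} → IsPerm (suc n) σ → ∃₂ λ α β → σ ≡ α ++ suc n ∷ β × IsPerm n (α ++ β)
IsPerm-split-max perm with ∈-∃++ (IsPerm⇒max∈ perm)
... | α , β , refl = α , β , refl , IsPerm-remove-max α perm

IsPerm-insert-max : ∀ {n} α {β} → IsPerm n (α ++ β) → IsPerm (suc n) (α ++ suc n ∷ β)
IsPerm-insert-max α (isPerm len inR u) =
  isPerm (trans (length-insert α) (cong suc len))
         (All-insert⁺ α (All.map (λ (lo , hi) → lo , m≤n⇒m≤1+n hi) inR) (s≤s z≤n , ≤-refl))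
         (Unique-insert⁺ α u (All.map (λ (_ , hi) x≡ → n≮n _ (subst (_≤ _) x≡ hi)) inR))

below-max : ∀ {n τ} → IsPerm n τ → All (_< suc n) τ
below-max perm = All.map (λ (_ , hi) → s≤s hi) (inRange perm)

++-∷-unique : ∀ {m : ℕ} xs {ys xs′ ys′} → m ∉ xs → m ∉ xs′ → xs ++ m ∷ ys ≡ xs′ ++ m ∷ ys′ → xs ≡ xs′ × ys ≡ ys′
++-∷-unique [] {xs′ = []} _ _ eq = refl , proj₂ (∷-injective eq)
++-∷-unique [] {xs′ = x′ ∷ xs′} _ m∉′ eq = contradiction (here (proj₁ (∷-injective eq))) m∉′
++-∷-unique (x ∷ xs) {xs′ = []} m∉ _ eq = contradiction (here (sym (proj₁ (∷-injective eq)))) m∉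
++-∷-unique (x ∷ xs) {xs′ = x′ ∷ xs′} m∉ m∉′ eq with ∷-injective eq
... | refl , eq′ with ++-∷-unique xs (m∉ ∘ there) (m∉′ ∘ there) eq′
...   | refl , refl = refl , refl

∉-below : ∀ {m : ℕ} {xs} → All (_< m) xs → m ∉ xs
∉-below below m∈ = n≮n _ (All.lookup below m∈)

IsPerm-suc⇒≢[] : ∀ {n σ} → IsPerm (suc n) σ → σ ≢ []
IsPerm-suc⇒≢[] (isPerm () _ _) refl

IsPerm-[1] : IsPerm 1 (1 ∷ [])
IsPerm-[1] = isPerm refl ((s≤s z≤n , s≤s z≤n) ∷ []) ([] ∷ [])

IsPerm-1⇒≡[1] : ∀ {σ} → IsPerm 1 σ → σ ≡ 1 ∷ []
IsPerm-1⇒≡[1] (isPerm refl ((s≤s z≤n , s≤s z≤n) ∷ []) _) = refl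

data Binary : List ℕ → Set where
  []  : Binary []
  0∷_ : ∀ {x} → Binary x → Binary (0 ∷ x)
  1∷_ : ∀ {x} → Binary x → Binary (1 ∷ x)

∈-bits⁻ : ∀ m {x} → x ∈ bits m → Binary x × length x ≡ m
∈-bits⁻ m x∈ with ∈-words⁻ m x∈
... | len , bits = binary bits , len
  where
  binary : ∀ {x} → All (_∈ 0 ∷ 1 ∷ []) x → Binary x
  binary [] = []
  binary (here refl ∷ bs) = 0∷ binary bs
  binary (there (here refl) ∷ bs) = 1∷ binary bs

∈-bits⁺ : ∀ {x} → Binary x → x ∈ bits (length x)
∈-bits⁺ b = ∈-words⁺ _ (digits b)
  where
  digits : ∀ {x} → Binary x → All (_∈ 0 ∷ 1 ∷ []) x
  digits [] = []
  digits (0∷ b) = here refl ∷ digits b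
  digits (1∷ b) = there (here refl) ∷ digits b

Unique-bits : ∀ m → Unique (bits m)
Unique-bits m = Unique-words m (((λ ()) ∷ []) ∷ [] ∷ [])

maximum-≤ : ∀ {k} xs → All (_≤ k) xs → maximum xs ≤ k
maximum-≤ [] [] = z≤n
maximum-≤ (x ∷ xs) (x≤k ∷ xs≤k) = ⊔-lub x≤k (maximum-≤ xs xs≤k)

∈⇒≤maximum : ∀ {x} xs → x ∈ xs → x ≤ maximum xs
∈⇒≤maximum (y ∷ xs) (here refl) = m≤m⊔n y _
∈⇒≤maximum (y ∷ xs) (there x∈) = ≤-trans (∈⇒≤maximum xs x∈) (m≤n⊔m y _)

maximum-attained : ∀ xs → maximum xs ≡ 0 ⊎ maximum xs ∈ xs
maximum-attained [] = inj₁ refl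
maximum-attained (x ∷ xs) with ⊔-sel x (maximum xs)
... | inj₁ eq = inj₂ (here eq)
... | inj₂ eq with maximum-attained xs
...   | inj₁ max≡0 = inj₁ (trans eq max≡0)
...   | inj₂ max∈  = inj₂ (there (subst (_∈ xs) (sym eq) max∈))

maximum-++ : ∀ xs ys → maximum (xs ++ ys) ≡ maximum xs ⊔ maximum ys
maximum-++ [] ys = refl
maximum-++ (x ∷ xs) ys = trans (cong (x ⊔_) (maximum-++ xs ys)) (sym (⊔-assoc x _ _))

module LongestChain (R : ℕ → ℕ → Set) (chain? : List ℕ → Bool)
  (chain?-sound : ∀ s → T (chain? s) → AllPairs R s)
  (chain?-complete : ∀ s → AllPairs R s → T (chain? s)) where

  longest : List ℕ → ℕ
  longest σ = maximum (map length (filterᵇ chain? (subseqs σ)))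

  longest-≤ : ∀ σ {k} → (∀ {s} → s ⊆ σ → AllPairs R s → length s ≤ k) → longest σ ≤ k
  longest-≤ σ bound = maximum-≤ _ (All.tabulate λ ℓ∈ → chain≤ ℓ∈)
    where
    chain≤ : ∀ {ℓ} → ℓ ∈ map length (filterᵇ chain? (subseqs σ)) → ℓ ≤ _
    chain≤ ℓ∈ with ∈-map⁻ length ℓ∈
    ... | s , s∈ , refl with ∈-filter⁻ (T? ∘ chain?) {xs = subseqs σ} s∈
    ...   | s∈′ , isChain = bound (∈-subseqs⇒⊆ σ s∈′) (chain?-sound s isChain)

  ≤-longest : ∀ {σ s} → s ⊆ σ → AllPairs R s → length s ≤ longest σ
  ≤-longest {σ} {s} s⊆σ chain =
    ∈⇒≤maximum _ (∈-map⁺ length (∈-filter⁺ (T? ∘ chain?) (⊆⇒∈-subseqs s⊆σ) (chain?-complete s chain)))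

  longest-attained : ∀ σ → ∃[ s ] (s ⊆ σ × AllPairs R s × length s ≡ longest σ)
  longest-attained σ with maximum-attained (map length (filterᵇ chain? (subseqs σ)))
  ... | inj₁ max≡0 = [] , minimum σ , [] , sym max≡0
  ... | inj₂ max∈ with ∈-map⁻ length max∈
  ...   | s , s∈ , eq with ∈-filter⁻ (T? ∘ chain?) {xs = subseqs σ} s∈
  ...     | s∈′ , isChain = s , ∈-subseqs⇒⊆ σ s∈′ , chain?-sound s isChain , sym eq

  longest-chain : ∀ {xs} → AllPairs R xs → longest xs ≡ length xs
  longest-chain {xs} chain = ≤-antisym (longest-≤ xs (λ sub _ → Sublist.length-mono-≤ sub)) (≤-longest ⊆-refl chain)

  longest-antichain : ∀ {xs} → AllPairs (λ a b → ¬ R a b) xs → longest xs ≤ 1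
  longest-antichain {xs} anti = longest-≤ xs short
    where
    short : ∀ {s} → s ⊆ xs → AllPairs R s → length s ≤ 1
    short {[]} _ _ = z≤n
    short {_ ∷ []} _ _ = s≤s z≤n
    short {_ ∷ _ ∷ _} sub ((r ∷ _) ∷ _) with AllPairs-resp-⊇ sub anti
    ... | (¬r ∷ _) ∷ _ = contradiction r ¬r

  longest-[x] : ∀ x → longest (x ∷ []) ≡ 1
  longest-[x] x = longest-chain ([] ∷ [])

  longest-++-related : ∀ A B → All (λ a → All (R a) B) A → longest (A ++ B) ≡ longest A + longest B
  longest-++-related A B cross = ≤-antisym (longest-≤ (A ++ B) split) glue
    where
    split : ∀ {s} → s ⊆ A ++ B → AllPairs R s → length s ≤ longest A + longest B
    split sub chain with ⊆-++⁻ A sub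
    ... | s₁ , s₂ , refl , sub₁ , sub₂ with AllPairs-++⁻ s₁ chain
    ...   | chain₁ , chain₂ , _ =
      subst (_≤ _) (sym (length-++ s₁)) (+-mono-≤ (≤-longest sub₁ chain₁) (≤-longest sub₂ chain₂))
    glue : longest A + longest B ≤ longest (A ++ B)
    glue with longest-attained A | longest-attained B
    ... | s₁ , sub₁ , chain₁ , len₁ | s₂ , sub₂ , chain₂ , len₂ =
      subst (_≤ _) (trans (length-++ s₁) (cong₂ _+_ len₁ len₂))
        (≤-longest (Sublist.++⁺ sub₁ sub₂)
                   (AllPairs.++⁺ chain₁ chain₂ (Sublist.All-resp-⊆ sub₁ (All.map (Sublist.All-resp-⊆ sub₂) cross))))

  longest-++-unrelated : ∀ A B → All (λ a → All (λ b → ¬ R a b) B) A → longest (A ++ B) ≡ longest A ⊔ longest B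
  longest-++-unrelated A B cross =
    ≤-antisym (longest-≤ (A ++ B) split)
              (⊔-lub (grow (Sublist.++⁺ʳ B ⊆-refl) (longest-attained A)) (grow (Sublist.++⁺ˡ A ⊆-refl) (longest-attained B)))
    where
    split : ∀ {s} → s ⊆ A ++ B → AllPairs R s → length s ≤ longest A ⊔ longest B
    split sub chain with ⊆-++⁻ A sub
    ... | [] , s₂ , refl , _ , sub₂ = ≤-trans (≤-longest sub₂ chain) (m≤n⊔m (longest A) _)
    ... | s₁ , [] , refl , sub₁ , _ =
      subst (_≤ _) (cong length (sym (++-identityʳ s₁)))
        (≤-trans (≤-longest sub₁ (subst (AllPairs R) (++-identityʳ s₁) chain)) (m≤m⊔n _ (longest B)))
    ... | a ∷ s₁ , b ∷ s₂ , refl , sub₁ , sub₂ with AllPairs-++⁻ (a ∷ s₁) chain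
    ...   | _ , _ , (rab ∷ _) ∷ _ =
      contradiction rab (All.head (All.head (Sublist.All-resp-⊆ sub₁ (All.map (Sublist.All-resp-⊆ sub₂) cross))))
    grow : ∀ {C} → C ⊆ A ++ B → ∃[ s ] (s ⊆ C × AllPairs R s × length s ≡ longest C) → longest C ≤ longest (A ++ B)
    grow C⊆ (s , sub , chain , len) = subst (_≤ _) len (≤-longest (⊆-trans sub C⊆) chain)

∷-chain : ∀ (R : ℕ → ℕ → Set) → (∀ {a b c} → R a b → R b c → R a c) →
          ∀ {x y s} → R x y → AllPairs R (y ∷ s) → AllPairs R (x ∷ y ∷ s)
∷-chain R R-trans rxy (ry ∷ chain) = (rxy ∷ All.map (R-trans rxy) ry) ∷ ry ∷ chain

increasing⇒AllPairs : ∀ s → T (increasing s) → AllPairs _<_ s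
increasing⇒AllPairs [] _ = []
increasing⇒AllPairs (x ∷ []) _ = [] ∷ []
increasing⇒AllPairs (x ∷ y ∷ s) t =
  ∷-chain _<_ <-trans (<ᵇ⇒< x y (proj₁ (Equivalence.to T-∧ t)))
          (increasing⇒AllPairs (y ∷ s) (proj₂ (Equivalence.to T-∧ t)))

AllPairs⇒increasing : ∀ s → AllPairs _<_ s → T (increasing s)
AllPairs⇒increasing [] _ = _
AllPairs⇒increasing (x ∷ []) _ = _
AllPairs⇒increasing (x ∷ y ∷ s) ((x<y ∷ _) ∷ chain) =
  Equivalence.from T-∧ (<⇒<ᵇ x<y , AllPairs⇒increasing (y ∷ s) chain)

decreasing⇒AllPairs : ∀ s → T (decreasing s) → AllPairs _>_ s
decreasing⇒AllPairs [] _ = []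
decreasing⇒AllPairs (x ∷ []) _ = [] ∷ []
decreasing⇒AllPairs (x ∷ y ∷ s) t =
  ∷-chain _>_ (λ b<a c<b → <-trans c<b b<a) (<ᵇ⇒< y x (proj₁ (Equivalence.to T-∧ t)))
          (decreasing⇒AllPairs (y ∷ s) (proj₂ (Equivalence.to T-∧ t)))

AllPairs⇒decreasing : ∀ s → AllPairs _>_ s → T (decreasing s)
AllPairs⇒decreasing [] _ = _
AllPairs⇒decreasing (x ∷ []) _ = _
AllPairs⇒decreasing (x ∷ y ∷ s) ((y<x ∷ _) ∷ chain) =
  Equivalence.from T-∧ (<⇒<ᵇ y<x , AllPairs⇒decreasing (y ∷ s) chain)

module Inc = LongestChain _<_ increasing increasing⇒AllPairs AllPairs⇒increasing
module Dec = LongestChain _>_ decreasing decreasing⇒AllPairs AllPairs⇒decreasing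

LIS≤2 : ∀ {σ} → Avoids p123 σ → LIS σ ≤ 2
LIS≤2 {σ} avoid = Inc.longest-≤ σ short
  where
  short : ∀ {s} → s ⊆ σ → AllPairs _<_ s → length s ≤ 2
  short {[]} _ _ = z≤n
  short {_ ∷ []} _ _ = s≤s z≤n
  short {_ ∷ _ ∷ []} _ _ = s≤s (s≤s z≤n)
  short {a ∷ b ∷ c ∷ _} sub ((a<b ∷ a<c ∷ _) ∷ (b<c ∷ _) ∷ _) =
    contradiction (a , b , c , ⊆-trans (refl ∷ refl ∷ refl ∷ minimum _) sub , a<b , a<c , b<c) avoid

LDS≤2 : ∀ {σ} → Avoids p321 σ → LDS σ ≤ 2
LDS≤2 {σ} avoid = Dec.longest-≤ σ short
  where
  short : ∀ {s} → s ⊆ σ → AllPairs _>_ s → length s ≤ 2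
  short {[]} _ _ = z≤n
  short {_ ∷ []} _ _ = s≤s z≤n
  short {_ ∷ _ ∷ []} _ _ = s≤s (s≤s z≤n)
  short {a ∷ b ∷ c ∷ _} sub ((b<a ∷ c<a ∷ _) ∷ (c<b ∷ _) ∷ _) =
    contradiction (a , b , c , ⊆-trans (refl ∷ refl ∷ refl ∷ minimum _) sub , <⇒≤ b<a , <⇒≤ c<a , <⇒≤ c<b) avoid

Above : List ℕ → List ℕ → Set
Above α β = All (λ a → All (_< a) β) α

IsPerm-stack : ∀ {b k γ ρ} → IsPerm b ρ → length γ ≡ k → All (Between b (b + k)) γ → Unique γ → IsPerm (b + k) (γ ++ ρ)
IsPerm-stack {b} {k} {γ} (isPerm lenρ inRρ uρ) lenγ inRγ uγ =
  isPerm (trans (length-++ γ) (trans (cong₂ _+_ lenγ lenρ) (+-comm k b)))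
         (All.++⁺ (All.map (λ (lo , hi) → ≤-trans (s≤s z≤n) lo , hi) inRγ)
                  (All.map (λ (lo , hi) → lo , ≤-trans hi (m≤m+n b k)) inRρ))
         (Unique.++⁺ uγ uρ λ (x∈γ , x∈ρ) → <⇒≱ (proj₁ (All.lookup inRγ x∈γ)) (proj₂ (All.lookup inRρ x∈ρ)))

IsPerm-above-split : ∀ N α β → IsPerm N (α ++ β) → Above α β → All (Between (length β) N) α × IsPerm (length β) β
IsPerm-above-split N [] β perm _ = [] , subst (λ k → IsPerm k β) (sym (length≡ perm)) perm
IsPerm-above-split zero (a ∷ α) β perm _ = contradiction (length≡ perm) λ ()
IsPerm-above-split (suc N) (a ∷ α) β perm above with ∈-++⁻ (a ∷ α) (IsPerm⇒max∈ perm)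
... | inj₂ N∈β = contradiction (All.lookup (All.head above) N∈β) (≤⇒≯ (proj₂ (All.head (inRange perm))))
... | inj₁ N∈α with ∈-∃++ N∈α
...   | α₁ , α₂ , eq =
  subst (All (Between (length β) (suc N))) (sym eq)
        (All-insert⁺ α₁ (All.map (λ (lo , hi) → lo , m≤n⇒m≤1+n hi) (proj₁ ih)) (s≤s |β|≤N , ≤-refl)) ,
  proj₂ ih
  where
  perm′ : IsPerm (suc N) (α₁ ++ suc N ∷ (α₂ ++ β))
  perm′ = subst (IsPerm (suc N)) (trans (cong (_++ β) eq) (++-assoc α₁ (suc N ∷ α₂) β)) perm
  rest : IsPerm N ((α₁ ++ α₂) ++ β)
  rest = subst (IsPerm N) (sym (++-assoc α₁ α₂ β)) (IsPerm-remove-max α₁ perm′)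
  ih = IsPerm-above-split N (α₁ ++ α₂) β rest (Sublist.All-resp-⊆ (⊆-insert α₁) (subst (λ γ → Above γ β) eq above))
  |β|≤N : length β ≤ N
  |β|≤N = subst (length β ≤_) (trans (sym (length-++ (α₁ ++ α₂))) (length≡ rest)) (m≤n+m _ _)

ascRun : ℕ → ℕ → List ℕ
ascRun a zero = []
ascRun a (suc L) = suc a ∷ ascRun (suc a) L

descRun : ℕ → ℕ → List ℕ
descRun b zero = []
descRun b (suc K) = suc (b + K) ∷ descRun b K

length-ascRun : ∀ a L → length (ascRun a L) ≡ L
length-ascRun a zero = refl
length-ascRun a (suc L) = cong suc (length-ascRun (suc a) L)

length-descRun : ∀ b K → length (descRun b K) ≡ K
length-descRun b zero = refl
length-descRun b (suc K) = cong suc (length-descRun b K)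

ascRun-between : ∀ a L → All (Between a (a + L)) (ascRun a L)
ascRun-between a zero = []
ascRun-between a (suc L) =
  (≤-refl , subst (suc a ≤_) (sym (+-suc a L)) (s≤s (m≤m+n a L))) ∷
  All.map (λ (lo , hi) → <-trans (n<1+n a) lo , hi) (subst (λ c → All (Between (suc a) c) (ascRun (suc a) L)) (sym (+-suc a L)) (ascRun-between (suc a) L))

descRun-between : ∀ b K → All (Between b (b + K)) (descRun b K)
descRun-between b zero = []
descRun-between b (suc K) =
  (s≤s (m≤m+n b K) , ≤-reflexive (sym (+-suc b K))) ∷
  All.map (λ (lo , hi) → lo , ≤-trans hi (≤-trans (n≤1+n _) (≤-reflexive (sym (+-suc b K))))) (descRun-between b K)

ascRun-increasing : ∀ a L → AllPairs _<_ (ascRun a L)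
ascRun-increasing a zero = []
ascRun-increasing a (suc L) = All.map proj₁ (ascRun-between (suc a) L) ∷ ascRun-increasing (suc a) L

descRun-decreasing : ∀ b K → AllPairs _>_ (descRun b K)
descRun-decreasing b zero = []
descRun-decreasing b (suc K) = All.map (λ (_ , hi) → s≤s hi) (descRun-between b K) ∷ descRun-decreasing b K

ascRun-+ : ∀ a L₁ L₂ → ascRun a (L₁ + L₂) ≡ ascRun a L₁ ++ ascRun (a + L₁) L₂
ascRun-+ a zero L₂ = cong (λ c → ascRun c L₂) (sym (+-identityʳ a))
ascRun-+ a (suc L₁) L₂ =
  cong (suc a ∷_) (trans (ascRun-+ (suc a) L₁ L₂) (cong (λ c → ascRun (suc a) L₁ ++ ascRun c L₂) (sym (+-suc a L₁))))

ascRun-suc : ∀ a L → ascRun a (suc L) ≡ ascRun a L ++ suc (a + L) ∷ []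
ascRun-suc a L = trans (cong (ascRun a) (+-comm 1 L)) (ascRun-+ a L 1)

ascRun-above : ∀ {B ρ} → All (_≤ B) ρ → ∀ L → Above (ascRun B L) ρ
ascRun-above ρ≤B L = All.map (λ (B<a , _) → All.map (λ c≤B → ≤-<-trans c≤B B<a) ρ≤B) (ascRun-between _ L)

below-ascRun : ∀ {b xs} L → All (_≤ b) xs → All (λ a → All (a <_) (ascRun b L)) xs
below-ascRun L xs≤b = All.map (λ a≤b → All.map (λ (b<c , _) → ≤-<-trans a≤b b<c) (ascRun-between _ L)) xs≤b

LIS-ascRun : ∀ a L → LIS (ascRun a L) ≡ L
LIS-ascRun a L = trans (Inc.longest-chain (ascRun-increasing a L)) (length-ascRun a L)

LDS-descRun : ∀ b K → LDS (descRun b K) ≡ K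
LDS-descRun b K = trans (Dec.longest-chain (descRun-decreasing b K)) (length-descRun b K)

ascending⇒ascRun : ∀ b α → AllPairs _<_ α → All (Between b (b + length α)) α → α ≡ ascRun b (length α)
ascending⇒ascRun b [] _ _ = refl
ascending⇒ascRun b (a ∷ α) (a< ∷ inc) ((b<a , a≤) ∷ between) =
  cong₂ _∷_ a≡1+b (ascending⇒ascRun (suc b) α inc between′)
  where
  hi≡ : b + suc (length α) ≡ length α + suc b
  hi≡ = trans (+-comm b (suc (length α))) (sym (+-suc (length α) b))
  -- the length α values of α are distinct and lie in (a, b + suc (length α)]
  distinct-values : length α + a ≤ length α + suc b
  distinct-values = subst (length α + a ≤_) hi≡
            (Unique-Between⇒length≤ _ a≤ (All.zipWith (λ (a<x , (_ , x≤)) → a<x , x≤) (a< , between))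
                                       (AllPairs.map <⇒≢ inc))
  a≡1+b : a ≡ suc b
  a≡1+b = ≤-antisym (+-cancelˡ-≤ (length α) a (suc b) distinct-values) b<a
  between′ : All (Between (suc b) (suc b + length α)) α
  between′ = All.zipWith (λ {x} (a<x , (_ , x≤)) → subst (_< x) a≡1+b a<x , subst (x ≤_) (+-suc b _) x≤) (a< , between)

descending⇒descRun : ∀ b α → AllPairs _>_ α → All (Between b (b + length α)) α → α ≡ descRun b (length α)
descending⇒descRun b [] _ _ = refl
descending⇒descRun b (a ∷ α) (a> ∷ dec) ((b<a , a≤) ∷ between) =
  cong₂ _∷_ a≡ (descending⇒descRun b α dec between′)
  where
  -- a ∷ α consists of 1 + length α distinct values in (b, a]
  distinct-values : suc (length α + b) ≤ a
  distinct-values = Unique-Between⇒length≤ a (<⇒≤ b<a)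
            ((b<a , ≤-refl) ∷ All.zipWith (λ (x<a , (b<x , _)) → b<x , <⇒≤ x<a) (a> , between))
            (AllPairs.map (λ y<x x≡y → <-irrefl (sym x≡y) y<x) (a> ∷ dec))
  a≡ : a ≡ suc (b + length α)
  a≡ = ≤-antisym (subst (a ≤_) (+-suc b _) a≤) (subst (λ k → suc k ≤ a) (+-comm (length α) b) distinct-values)
  between′ : All (Between b (b + length α)) α
  between′ = All.zipWith (λ {x} (x<a , (b<x , _)) → b<x , ≤-pred (subst (x <_) a≡ x<a)) (a> , between)

IsPerm-ascRun : ∀ n → IsPerm n (ascRun 0 n)
IsPerm-ascRun n =
  subst (IsPerm n) (++-identityʳ _)
    (IsPerm-stack (isPerm refl [] []) (length-ascRun 0 n) (ascRun-between 0 n) (AllPairs.map <⇒≢ (ascRun-increasing 0 n)))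

sameDist-Encoding : ∀ {A : Set} {n x y z u v w} {P : List A} {φ : A → List ℕ} (f : List ℕ → ℕ) (g : A → ℕ) →
  Unique P → Encoding n (x ∷ y ∷ z ∷ []) (u ∷ v ∷ w ∷ []) P φ → (∀ {a} → a ∈ P → f (φ a) ≡ g a) →
  SameDist (Av n ((x ∷ y ∷ z ∷ []) ∷ (u ∷ v ∷ w ∷ []) ∷ [])) f P g
sameDist-Encoding f g uP enc fφ≡g = sameDist-↭ f g (map-↭-transport f g (Encoding⇒↭ uP enc) fφ≡g)

bitsEncoding : ∀ {p q : List ℕ} {φ : List ℕ → List ℕ} n →
  (∀ x → IsPerm (suc (length x)) (φ x) × Avoids₂ p q (φ x)) →
  (∀ {σ} → IsPerm (suc n) σ → Avoids₂ p q σ → ∃[ x ] (Binary x × length x ≡ n × σ ≡ φ x)) →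
  (∀ {x y} → Binary x → Binary y → length x ≡ length y → φ x ≡ φ y → x ≡ y) →
  Encoding (suc n) p q (bits n) φ
bitsEncoding {p} {q} {φ} n sound complete injective = record
  { sound     = sound′
  ; complete  = complete′
  ; injective = λ x∈ y∈ → injective (proj₁ (∈-bits⁻ n x∈)) (proj₁ (∈-bits⁻ n y∈))
                                      (trans (proj₂ (∈-bits⁻ n x∈)) (sym (proj₂ (∈-bits⁻ n y∈))))
  }
  where
  sound′ : ∀ {x} → x ∈ bits n → IsPerm (suc n) (φ x) × Avoids₂ p q (φ x)
  sound′ {x} x∈ with ∈-bits⁻ n x∈
  ... | _ , refl = sound x
  complete′ : ∀ {σ} → IsPerm (suc n) σ → Avoids₂ p q σ → ∃[ x ] (x ∈ bits n × σ ≡ φ x)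
  complete′ perm avoid with complete perm avoid
  ... | x , bin , refl , σ≡ = x , ∈-bits⁺ bin , σ≡

-- (b) T = {132, 231}

frontOrBack : List ℕ → List ℕ
frontOrBack [] = 1 ∷ []
frontOrBack (zero ∷ x) = suc (suc (length x)) ∷ frontOrBack x
frontOrBack (suc _ ∷ x) = frontOrBack x ++ suc (suc (length x)) ∷ []

frontOrBack-sound : ∀ x → IsPerm (suc (length x)) (frontOrBack x) × Avoids₂ p132 p231 (frontOrBack x)
frontOrBack-sound [] = IsPerm-[1] , Avoids-[x] {p132} , Avoids-[x] {p231}
frontOrBack-sound (zero ∷ x) with frontOrBack-sound x
... | perm , avoid₁ , avoid₂ =
  IsPerm-insert-max [] perm , Avoids-∷ {p132} avoid₁ not-first , Avoids-∷ {p231} avoid₂ not-first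
  where
  not-first : ∀ {b c : ℕ} {P : Set} → (b ∷ c ∷ []) ⊆ frontOrBack x → ¬ (suc (suc (length x)) < b × P)
  not-first sub (m<b , _) = <-asym (proj₁ (All-pair (below-max perm) sub)) m<b
frontOrBack-sound (suc _ ∷ x) with frontOrBack-sound x
... | perm , avoid₁ , avoid₂ =
  IsPerm-insert-max (frontOrBack x) (subst (IsPerm _) (sym (++-identityʳ _)) perm) ,
  Avoids-∷ʳ {p132} avoid₁ not-last , Avoids-∷ʳ {p231} avoid₂ not-last
  where
  not-last : ∀ {a b : ℕ} {P Q : Set} → (a ∷ b ∷ []) ⊆ frontOrBack x → ¬ (P × Q × suc (suc (length x)) ≤ b)
  not-last sub (_ , _ , m≤b) = <⇒≱ (proj₂ (All-pair (below-max perm) sub)) m≤b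

-- Otherwise a m c, with a before and c after the maximum m, is a 132 or a 231.
max-at-an-end : ∀ {n} α β → All (_< suc n) (α ++ β) → Avoids₂ p132 p231 (α ++ suc n ∷ β) → α ≡ [] ⊎ β ≡ []
max-at-an-end [] β _ _ = inj₁ refl
max-at-an-end (a ∷ α) [] _ _ = inj₂ refl
max-at-an-end {n} (a ∷ α) (c ∷ β) (a<m ∷ below) (avoid₁ , avoid₂) =
  ⊥-elim (a-m-c (All.head (All.++⁻ʳ α below)) (refl ∷ Sublist.++⁺ˡ α (refl ∷ refl ∷ minimum β)))
  where
  a-m-c : c < suc n → (a ∷ suc n ∷ c ∷ []) ⊆ (a ∷ α) ++ suc n ∷ c ∷ β → ⊥
  a-m-c c<m sub with a <? c
  ... | yes a<c = avoid₁ (a , suc n , c , sub , a<m , a<c , <⇒≤ c<m)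
  ... | no a≮c  = avoid₂ (a , suc n , c , sub , a<m , ≮⇒≥ a≮c , <⇒≤ c<m)

frontOrBack-complete : ∀ n {σ} → IsPerm (suc n) σ → Avoids₂ p132 p231 σ →
                       ∃[ x ] (Binary x × length x ≡ n × σ ≡ frontOrBack x)
frontOrBack-complete zero perm _ = [] , [] , refl , IsPerm-1⇒≡[1] perm
frontOrBack-complete (suc n) perm (avoid₁ , avoid₂) with IsPerm-split-max perm
... | α , β , refl , perm′
  with frontOrBack-complete n perm′ (Avoids-anti {p132} (⊆-insert α) avoid₁ , Avoids-anti {p231} (⊆-insert α) avoid₂)
...   | x , bin , refl , αβ≡ with max-at-an-end α β (below-max perm′) (avoid₁ , avoid₂)
...     | inj₁ refl = 0 ∷ x , 0∷ bin , refl , cong (_ ∷_) αβ≡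
...     | inj₂ refl = 1 ∷ x , 1∷ bin , refl , cong (_++ _) (trans (sym (++-identityʳ α)) αβ≡)

head-not-below : ∀ {m : ℕ} {τ} ρ {ys} → All (_< m) ρ → ρ ≢ [] → m ∷ τ ≢ ρ ++ ys
head-not-below [] _ ρ≢[] _ = ρ≢[] refl
head-not-below (h ∷ ρ) (h<m ∷ _) _ eq = <-irrefl (sym (proj₁ (∷-injective eq))) h<m

frontOrBack-injective : ∀ {x y} → Binary x → Binary y → length x ≡ length y → frontOrBack x ≡ frontOrBack y → x ≡ y
frontOrBack-injective [] [] _ _ = refl
frontOrBack-injective (0∷ bx) (0∷ by) len eq =
  cong (0 ∷_) (frontOrBack-injective bx by (suc-injective len) (proj₂ (∷-injective eq)))
frontOrBack-injective (1∷ bx) (1∷ by) len eq =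
  cong (1 ∷_) (frontOrBack-injective bx by (suc-injective len) (∷ʳ-injectiveˡ _ _ eq))
frontOrBack-injective {0 ∷ x} {1 ∷ y} (0∷ _) (1∷ _) len eq = ⊥-elim $
  head-not-below (frontOrBack y) (subst (λ k → All (_< suc (suc k)) _) (sym (suc-injective len)) (below-max perm))
                 (IsPerm-suc⇒≢[] perm) eq
  where perm = proj₁ (frontOrBack-sound y)
frontOrBack-injective {1 ∷ x} {0 ∷ y} (1∷ _) (0∷ _) len eq = ⊥-elim $
  head-not-below (frontOrBack x) (subst (λ k → All (_< suc (suc k)) _) (suc-injective len) (below-max perm))
                 (IsPerm-suc⇒≢[] perm) (sym eq)
  where perm = proj₁ (frontOrBack-sound x)

complement : List ℕ → List ℕ
complement = map (1 ∸_)

LIS-frontOrBack : ∀ {x} → Binary x → LIS (frontOrBack x) ≡ Bin+1 x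
LIS-frontOrBack [] = Inc.longest-[x] 1
LIS-frontOrBack {0 ∷ x} (0∷ b) =
  trans (Inc.longest-++-unrelated (suc (suc (length x)) ∷ []) (frontOrBack x) (All.map (λ b<m m<b → <-asym b<m m<b) below ∷ []))
        (cong₂ _⊔_ (Inc.longest-[x] (suc (suc (length x)))) (LIS-frontOrBack b))
  where below = below-max (proj₁ (frontOrBack-sound x))
LIS-frontOrBack {1 ∷ x} (1∷ b) =
  trans (Inc.longest-++-related (frontOrBack x) (suc (suc (length x)) ∷ []) (All.map (_∷ []) below))
        (trans (cong₂ _+_ (LIS-frontOrBack b) (Inc.longest-[x] (suc (suc (length x))))) (cong suc (+-comm (sum x) 1)))
  where below = below-max (proj₁ (frontOrBack-sound x))

LDS-frontOrBack : ∀ {x} → Binary x → LDS (frontOrBack x) ≡ Bin+1 (complement x)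
LDS-frontOrBack [] = Dec.longest-[x] 1
LDS-frontOrBack {0 ∷ x} (0∷ b) =
  trans (Dec.longest-++-related (suc (suc (length x)) ∷ []) (frontOrBack x) (below ∷ []))
        (cong₂ _+_ (Dec.longest-[x] (suc (suc (length x)))) (LDS-frontOrBack b))
  where below = below-max (proj₁ (frontOrBack-sound x))
LDS-frontOrBack {1 ∷ x} (1∷ b) =
  trans (Dec.longest-++-unrelated (frontOrBack x) (suc (suc (length x)) ∷ []) (All.map (λ a<m → (λ m<a → <-asym a<m m<a) ∷ []) below))
        (trans (cong₂ _⊔_ (LDS-frontOrBack b) (Dec.longest-[x] (suc (suc (length x))))) (cong suc (⊔-identityʳ _)))
  where below = below-max (proj₁ (frontOrBack-sound x))

complement-binary : ∀ {x} → Binary x → Binary (complement x) × complement (complement x) ≡ x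
complement-binary [] = [] , refl
complement-binary (0∷ b) = 1∷ proj₁ (complement-binary b) , cong (0 ∷_) (proj₂ (complement-binary b))
complement-binary (1∷ b) = 0∷ proj₁ (complement-binary b) , cong (1 ∷_) (proj₂ (complement-binary b))

complement-↭ : ∀ n → map complement (bits n) ↭ bits n
complement-↭ n = map-involution-↭ complement (Unique-bits n) closed (λ x∈ → proj₂ (complement-binary (proj₁ (∈-bits⁻ n x∈))))
  where
  closed : ∀ {x} → x ∈ bits n → complement x ∈ bits n
  closed {x} x∈ with ∈-bits⁻ n x∈
  ... | b , refl = subst (λ k → complement x ∈ bits k) (length-map (1 ∸_) x) (∈-bits⁺ (proj₁ (complement-binary b)))

frontOrBack-encoding : ∀ n → Encoding (suc n) p132 p231 (bits n) frontOrBack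
frontOrBack-encoding n = bitsEncoding n frontOrBack-sound (frontOrBack-complete n) frontOrBack-injective

LIS-132-231 : ∀ n → SameDist (Av (suc n) (p132 ∷ p231 ∷ [])) LIS (bits n) Bin+1
LIS-132-231 n = sameDist-Encoding LIS Bin+1 (Unique-bits n) (frontOrBack-encoding n)
                  (λ x∈ → LIS-frontOrBack (proj₁ (∈-bits⁻ n x∈)))

-- LDS is Bin+1 of the complemented string, and complementing permutes bits n.
LDS-132-231 : ∀ n → SameDist (Av (suc n) (p132 ∷ p231 ∷ [])) LDS (bits n) Bin+1
LDS-132-231 n = sameDist-↭ LDS Bin+1
  (↭-trans (map-↭-transport LDS (Bin+1 ∘ complement) (Encoding⇒↭ (Unique-bits n) (frontOrBack-encoding n))
                            (λ x∈ → LDS-frontOrBack (proj₁ (∈-bits⁻ n x∈))))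
  (↭-trans (↭-reflexive (map-∘ (bits n))) (Perm.map⁺ Bin+1 (complement-↭ n))))

Binary-zeros : ∀ K {y} → Binary y → Binary (replicate K 0 ++ y)
Binary-zeros zero b = b
Binary-zeros (suc K) b = 0∷ Binary-zeros K b

replicate-∷ : ∀ K (x : List ℕ) → replicate K 0 ++ 0 ∷ x ≡ replicate (suc K) 0 ++ x
replicate-∷ zero x = refl
replicate-∷ (suc K) x = cong (0 ∷_) (replicate-∷ K x)

module MaxAfterRun (run : ℕ → ℕ → List ℕ) (R : ℕ → ℕ → Set)
  (length-run : ∀ b L → length (run b L) ≡ L)
  (run-between : ∀ b L → All (Between b (b + L)) (run b L))
  (run-chain : ∀ b L → AllPairs R (run b L))
  (R⇒≢ : ∀ {x y} → R x y → x ≢ y)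
  (chain⇒run : ∀ b α → AllPairs R α → All (Between b (b + length α)) α → α ≡ run b (length α))
  where

  -- block L x encodes the binary string 0^L ++ x.
  block : ℕ → List ℕ → List ℕ
  block L [] = run 0 L ++ suc L ∷ []
  block L (zero ∷ x) = block (suc L) x
  block L (suc _ ∷ x) = run (suc (length x)) L ++ suc (suc (length x) + L) ∷ block 0 x

  block-zeros : ∀ K L y → block L (replicate K 0 ++ y) ≡ block (K + L) y
  block-zeros zero L y = refl
  block-zeros (suc K) L y = trans (block-zeros K (suc L) y) (cong (λ k → block k y) (+-suc K L))

  block-zeros′ : ∀ K y → block 0 (replicate K 0 ++ y) ≡ block K y
  block-zeros′ K y = trans (block-zeros K 0 y) (cong (λ k → block k y) (+-identityʳ K))

  IsPerm-stack-max : ∀ {b L ρ} → IsPerm b ρ → IsPerm (suc (b + L)) (run b L ++ suc (b + L) ∷ ρ)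
  IsPerm-stack-max {b} {L} perm =
    IsPerm-insert-max (run b L) (IsPerm-stack perm (length-run b L) (run-between b L) (AllPairs.map R⇒≢ (run-chain b L)))

  block-perm : ∀ L x → IsPerm (suc (L + length x)) (block L x)
  block-perm L [] = subst (λ k → IsPerm (suc k) (block L [])) (sym (+-identityʳ L)) (IsPerm-stack-max (isPerm refl [] []))
  block-perm L (zero ∷ x) = subst (λ k → IsPerm (suc k) (block L (zero ∷ x))) (sym (+-suc L _)) (block-perm (suc L) x)
  block-perm L (suc b ∷ x) = subst (λ k → IsPerm (suc k) (block L (suc b ∷ x))) (+-comm (suc (length x)) L) (IsPerm-stack-max (block-perm 0 x))

  max∉run : ∀ b L → suc (b + L) ∉ run b L
  max∉run b L M∈ = n≮n _ (proj₂ (All.lookup (run-between b L) M∈))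

  -- The maximum occurs only once, so it splits both sides at the same place.
  stack-injective : ∀ {b b′ L L′ ρ ρ′} → suc (b + L) ≡ suc (b′ + L′) →
                    run b L ++ suc (b + L) ∷ ρ ≡ run b′ L′ ++ suc (b′ + L′) ∷ ρ′ → L ≡ L′ × ρ ≡ ρ′
  stack-injective {b} {b′} {L} {L′} {ρ′ = ρ′} M≡ eq
    with ++-∷-unique (run b L) (max∉run b L) (subst (_∉ run b′ L′) (sym M≡) (max∉run b′ L′))
                     (trans eq (cong (λ m → run b′ L′ ++ m ∷ ρ′) (sym M≡)))
  ... | runs≡ , ρ≡ = trans (sym (length-run b L)) (trans (cong length runs≡) (length-run b′ L′)) , ρ≡

  block-injective : ∀ {L L′ x y} → Binary x → Binary y → L + length x ≡ L′ + length y →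
                    block L x ≡ block L′ y → replicate L 0 ++ x ≡ replicate L′ 0 ++ y
  block-injective {L} {x = 0 ∷ x} (0∷ bx) by len eq =
    trans (replicate-∷ L x) (block-injective bx by (trans (sym (+-suc L _)) len) eq)
  block-injective {L′ = L′} {y = 0 ∷ y} bx@([]) (0∷ by) len eq =
    trans (block-injective bx by (trans len (+-suc L′ _)) eq) (sym (replicate-∷ L′ y))
  block-injective {L′ = L′} {y = 0 ∷ y} bx@(1∷ _) (0∷ by) len eq =
    trans (block-injective bx by (trans len (+-suc L′ _)) eq) (sym (replicate-∷ L′ y))
  block-injective {L} {L′} [] [] len eq with stack-injective {0} {0} (cong suc (trans (sym (+-identityʳ L)) (trans len (+-identityʳ L′)))) eq
  ... | refl , _ = refl
  block-injective {L} {L′} {y = 1 ∷ y} [] (1∷ by) len eq with stack-injective {0} {suc (length y)} M≡ eq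
    where M≡ = cong suc (trans (sym (+-identityʳ L)) (trans len (+-comm L′ _)))
  ... | _ , []≡ = contradiction (sym []≡) (IsPerm-suc⇒≢[] (block-perm 0 y))
  block-injective {L} {L′} {x = 1 ∷ x} (1∷ bx) [] len eq with stack-injective {suc (length x)} {0} M≡ eq
    where M≡ = cong suc (trans (+-comm _ L) (trans len (+-identityʳ L′)))
  ... | _ , ≡[] = contradiction ≡[] (IsPerm-suc⇒≢[] (block-perm 0 x))
  block-injective {L} {L′} {1 ∷ x} {1 ∷ y} (1∷ bx) (1∷ by) len eq
    with stack-injective {suc (length x)} {suc (length y)} (cong suc (trans (+-comm _ L) (trans len (+-comm L′ _)))) eq
  ... | refl , ρ≡ = cong (λ z → replicate L 0 ++ 1 ∷ z) (block-injective bx by (suc-injective (+-cancelˡ-≡ L _ _ len)) ρ≡)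

  module Avoiders (p q : List ℕ)
    (Avoids-stack : ∀ {b L ρ} → All (_≤ b) ρ → Avoids₂ p q ρ → Avoids₂ p q (run b L ++ suc (b + L) ∷ ρ))
    (avoider-shape : ∀ {n α β} → IsPerm n (α ++ β) → Avoids₂ p q (α ++ suc n ∷ β) → AllPairs R α × Above α β)
    where

    block-avoids : ∀ L x → Avoids₂ p q (block L x)
    block-avoids L [] = Avoids-stack [] (Avoids-[] {p} , Avoids-[] {q})
    block-avoids L (zero ∷ x) = block-avoids (suc L) x
    block-avoids L (suc _ ∷ x) = Avoids-stack (All.map proj₂ (inRange (block-perm 0 x))) (block-avoids 0 x)

    Complete : ℕ → Set
    Complete n = ∀ {σ} → IsPerm (suc n) σ → Avoids₂ p q σ → ∃[ x ] (Binary x × length x ≡ n × σ ≡ block 0 x)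

    stack-block : ∀ K n β → length β + K ≡ n → IsPerm (length β) β → Avoids₂ p q β → (∀ {m} → m < n → Complete m) →
                  ∃[ x ] (Binary x × length x ≡ n × run (length β) K ++ suc n ∷ β ≡ block 0 x)
    stack-block K _ [] refl _ _ _ =
      replicate K 0 ++ [] , Binary-zeros K [] ,
      trans (length-++ (replicate K 0)) (trans (+-identityʳ _) (length-replicate K)) ,
      sym (block-zeros′ K [])
    stack-block K _ (c ∷ β) refl perm avoid ih with ih (s≤s (m≤m+n (length β) K)) perm avoid
    ... | x , bin , len , β≡ =
      replicate K 0 ++ 1 ∷ x , Binary-zeros K (1∷ bin) ,
      trans (length-++ (replicate K 0)) (trans (cong₂ _+_ (length-replicate K) (cong suc len)) (+-comm K _)) ,
      trans (cong₂ (λ b ρ → run b K ++ suc (b + K) ∷ ρ) (cong suc (sym len)) β≡) (sym (block-zeros′ K (1 ∷ x)))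

    block-complete : ∀ n → Complete n
    block-complete = <-rec Complete step
      where
      step : ∀ n → (∀ {m} → m < n → Complete m) → Complete n
      step n ih perm (avoid₁ , avoid₂) with IsPerm-split-max perm
      ... | α , β , refl , perm′ with avoider-shape perm′ (avoid₁ , avoid₂)
      ...   | chain , above with IsPerm-above-split n α β perm′ above
      ...     | between , permβ with trans (+-comm (length β) (length α)) (trans (sym (length-++ α)) (length≡ perm′))
      ...       | n≡ with stack-block (length α) n β n≡ permβ
                                      (Avoids-anti {p} (Sublist.++⁺ˡ α (_ ∷ʳ ⊆-refl)) avoid₁ ,
                                       Avoids-anti {q} (Sublist.++⁺ˡ α (_ ∷ʳ ⊆-refl)) avoid₂) ih
      ...         | x , bin , len , σ≡ =
        x , bin , len ,
        trans (cong (_++ _) (chain⇒run (length β) α chain (subst (λ k → All (Between (length β) k) α) (sym n≡) between))) σ≡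

Avoids-132⇒Above : ∀ {n α β} → IsPerm n (α ++ β) → Avoids p132 (α ++ suc n ∷ β) → Above α β
Avoids-132⇒Above {n} {α} {β} perm avoid = All.tabulate λ a∈ → All.tabulate λ c∈ → c<a a∈ c∈
  where
  c<a : ∀ {a c} → a ∈ α → c ∈ β → c < a
  c<a {a} {c} a∈ c∈ with a <? c
  ... | yes a<c = contradiction (a , suc n , c , Sublist.++⁺ (from∈ a∈) (refl ∷ from∈ c∈) ,
                                 All.lookup (below-max perm) (∈-++⁺ˡ a∈) , a<c , <⇒≤ (All.lookup (below-max perm) (∈-++⁺ʳ α c∈)))
                                avoid
  ... | no a≮c = ≤∧≢⇒< (≮⇒≥ a≮c) (λ c≡a → Unique-++⇒≢ α (unique perm) a∈ c∈ (sym c≡a))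

leadingZeros : List ℕ → ℕ
leadingZeros (zero ∷ x) = suc (leadingZeros x)
leadingZeros _ = 0

allZero : List ℕ → Bool
allZero = all (_≡ᵇ 0)

maximum-map-suc : ∀ y ys → maximum (map suc (y ∷ ys)) ≡ suc (maximum (y ∷ ys))
maximum-map-suc y [] = trans (⊔-identityʳ (suc y)) (cong suc (sym (⊔-identityʳ y)))
maximum-map-suc y (z ∷ ys) = cong (suc y ⊔_) (maximum-map-suc z ys)

filter-allZero-0∷ : ∀ I → filterᵇ allZero (map (0 ∷_) I) ≡ map (0 ∷_) (filterᵇ allZero I)
filter-allZero-0∷ [] = refl
filter-allZero-0∷ (s ∷ I) with allZero s
... | true  = cong ((0 ∷ s) ∷_) (filter-allZero-0∷ I)
... | false = filter-allZero-0∷ I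

filter-allZero-suc∷ : ∀ k I → filterᵇ allZero (map (suc k ∷_) I) ≡ []
filter-allZero-suc∷ k [] = refl
filter-allZero-suc∷ k (s ∷ I) = filter-allZero-suc∷ k I

longest-zero-prefix : ∀ x → maximum (map length (filterᵇ allZero (inits x))) ≡ leadingZeros x
longest-zero-prefix [] = refl
longest-zero-prefix (zero ∷ x) = begin
  maximum (map length (filterᵇ allZero (map (0 ∷_) (inits x))))   ≡⟨ cong (maximum ∘ map length) (filter-allZero-0∷ (inits x)) ⟩
  maximum (map length (map (0 ∷_) (filterᵇ allZero (inits x))))   ≡⟨ cong maximum (trans (sym (map-∘ {g = length} {f = 0 ∷_} F)) (map-∘ {g = suc} {f = length} F)) ⟩
  maximum (map suc (map length (filterᵇ allZero (inits x))))      ≡⟨ maximum-map-suc 0 (map length (filterᵇ allZero (Inits.tail x))) ⟩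
  suc (maximum (map length (filterᵇ allZero (inits x))))          ≡⟨ cong suc (longest-zero-prefix x) ⟩
  suc (leadingZeros x)                                             ∎
  where
  open ≡-Reasoning
  F = filterᵇ allZero (inits x)
longest-zero-prefix (suc k ∷ x) = cong (maximum ∘ map length) (filter-allZero-suc∷ k (inits x))

R-∷ : ∀ b x → R (b ∷ x) ≡ leadingZeros (b ∷ x) ⊔ R x
R-∷ b x = begin
  maximum (map length (filterᵇ allZero (inits (b ∷ x) ++ segments x)))
    ≡⟨ cong (maximum ∘ map length) (filter-++ (T? ∘ allZero) (inits (b ∷ x)) (segments x)) ⟩
  maximum (map length (filterᵇ allZero (inits (b ∷ x)) ++ filterᵇ allZero (segments x)))
    ≡⟨ cong maximum (map-++ length (filterᵇ allZero (inits (b ∷ x))) _) ⟩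
  maximum (map length (filterᵇ allZero (inits (b ∷ x))) ++ map length (filterᵇ allZero (segments x)))
    ≡⟨ maximum-++ (map length (filterᵇ allZero (inits (b ∷ x)))) _ ⟩
  maximum (map length (filterᵇ allZero (inits (b ∷ x)))) ⊔ R x
    ≡⟨ cong (_⊔ R x) (longest-zero-prefix (b ∷ x)) ⟩
  leadingZeros (b ∷ x) ⊔ R x ∎
  where open ≡-Reasoning

leadingZeros-replicate : ∀ L → leadingZeros (replicate L 0) ≡ L
leadingZeros-replicate zero = refl
leadingZeros-replicate (suc L) = cong suc (leadingZeros-replicate L)

leadingZeros-replicate-1∷ : ∀ L y → leadingZeros (replicate L 0 ++ 1 ∷ y) ≡ L
leadingZeros-replicate-1∷ zero y = refl
leadingZeros-replicate-1∷ (suc L) y = cong suc (leadingZeros-replicate-1∷ L y)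

R-replicate : ∀ L → R (replicate L 0) ≡ L
R-replicate zero = refl
R-replicate (suc L) =
  trans (R-∷ 0 (replicate L 0)) (trans (cong₂ (λ a r → suc a ⊔ r) (leadingZeros-replicate L) (R-replicate L)) (m≥n⇒m⊔n≡m (n≤1+n L)))

R-replicate-1∷ : ∀ L y → R (replicate L 0 ++ 1 ∷ y) ≡ L ⊔ R y
R-replicate-1∷ zero y = R-∷ 1 y
R-replicate-1∷ (suc L) y =
  trans (R-∷ 0 (replicate L 0 ++ 1 ∷ y)) (trans (cong₂ (λ a r → suc a ⊔ r) (leadingZeros-replicate-1∷ L y) (R-replicate-1∷ L y))
                         (trans (sym (⊔-assoc (suc L) L (R y))) (cong (_⊔ R y) (m≥n⇒m⊔n≡m (n≤1+n L)))))

-- (d) T = {132, 213}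

Avoids-ascStack : ∀ {b L ρ} → All (_≤ b) ρ → Avoids₂ p132 p213 ρ →
                  Avoids₂ p132 p213 (ascRun b L ++ suc (b + L) ∷ ρ)
Avoids-ascStack {b} {L} {ρ} ρ≤b (avoid₁ , avoid₂) = no132 , no213
  where
  below : ∀ {x y} → x ∈ ascRun b L → y ∈ ρ → y < x
  below x∈ y∈ = ≤-<-trans (All.lookup ρ≤b y∈) (proj₁ (All.lookup (ascRun-between b L) x∈))
  run<M : ∀ {x} → x ∈ ascRun b L → x < suc (b + L)
  run<M x∈ = s≤s (proj₂ (All.lookup (ascRun-between b L) x∈))
  ρ<M : ∀ {y} → y ∈ ρ → y < suc (b + L)
  ρ<M y∈ = s≤s (≤-trans (All.lookup ρ≤b y∈) (m≤m+n b L))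
  inc : ∀ {x y} → (x ∷ y ∷ []) ⊆ ascRun b L → x < y
  inc sub = AllPairs-pair sub (ascRun-increasing b L)
  no132 : Avoids p132 (ascRun b L ++ suc (b + L) ∷ ρ)
  no132 (x , y , z , sub , x<y , x<z , z≤y) with tripleView (ascRun b L) sub
  ... | first sub′   = <-asym x<z (ρ<M (⊆-∈ sub′ (there (here refl))))
  ... | middle x∈ z∈ = <-asym x<z (below x∈ z∈)
  ... | last sub′    = <⇒≱ (run<M (⊆-∈ sub′ (there (here refl)))) z≤y
  ... | unused sub′ with tripleIn++ (ascRun b L) sub′
  ...   | left sub″      = <⇒≱ (inc (⊆-trans (_ ∷ʳ ⊆-refl) sub″)) z≤y
  ...   | left₂ sub″ z∈  = <-asym x<z (below (⊆-∈ sub″ (here refl)) z∈)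
  ...   | left₁ x∈ sub″  = <-asym x<z (below x∈ (⊆-∈ sub″ (there (here refl))))
  ...   | right sub″     = avoid₁ (x , y , z , sub″ , x<y , x<z , z≤y)
  no213 : Avoids p213 (ascRun b L ++ suc (b + L) ∷ ρ)
  no213 (x , y , z , sub , y≤x , x<z , y<z) with tripleView (ascRun b L) sub
  ... | first sub′   = <-asym x<z (ρ<M (⊆-∈ sub′ (there (here refl))))
  ... | middle x∈ z∈ = <-asym x<z (below x∈ z∈)
  ... | last sub′    = <⇒≱ (inc sub′) y≤x
  ... | unused sub′ with tripleIn++ (ascRun b L) sub′
  ...   | left sub″      = <⇒≱ (inc (⊆-trans (refl ∷ refl ∷ _ ∷ʳ []) sub″)) y≤x
  ...   | left₂ sub″ z∈  = <-asym x<z (below (⊆-∈ sub″ (here refl)) z∈)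
  ...   | left₁ x∈ sub″  = <-asym x<z (below x∈ (⊆-∈ sub″ (there (here refl))))
  ...   | right sub″     = avoid₂ (x , y , z , sub″ , y≤x , x<z , y<z)

-- Left of the maximum, a descent x > y would form 213 with the maximum.
avoider-shape-132-213 : ∀ {n α β} → IsPerm n (α ++ β) → Avoids₂ p132 p213 (α ++ suc n ∷ β) → AllPairs _<_ α × Above α β
avoider-shape-132-213 {n} {α} {β} perm (avoid₁ , avoid₂) = pairs⇒AllPairs α ascent , Avoids-132⇒Above perm avoid₁
  where
  ascent : ∀ {x y} → (x ∷ y ∷ []) ⊆ α → x < y
  ascent {x} {y} sub with x <? y
  ... | yes x<y = x<y
  ... | no x≮y = contradiction (x , y , suc n , Sublist.++⁺ sub (refl ∷ minimum β) , ≮⇒≥ x≮y ,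
                                All.lookup below (⊆-∈ sub (here refl)) , All.lookup below (⊆-∈ sub (there (here refl))))
                               avoid₂
    where below = All.++⁻ˡ α (below-max perm)

module AscBlocks = MaxAfterRun ascRun _<_ length-ascRun ascRun-between ascRun-increasing <⇒≢ ascending⇒ascRun
open AscBlocks using () renaming (block to ascBlock)

ascBlock-encoding : ∀ n → Encoding (suc n) p132 p213 (bits n) (ascBlock 0)
ascBlock-encoding n =
  bitsEncoding n (λ x → AscBlocks.block-perm 0 x , block-avoids 0 x) (block-complete n)
                 (λ bx by len eq → AscBlocks.block-injective bx by len eq)
  where open AscBlocks.Avoiders p132 p213 Avoids-ascStack avoider-shape-132-213

ascStack≡ : ∀ b L ρ → ascRun b L ++ suc (b + L) ∷ ρ ≡ ascRun b (suc L) ++ ρ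
ascStack≡ b L ρ = trans (sym (++-assoc (ascRun b L) _ ρ)) (cong (_++ ρ) (sym (ascRun-suc b L)))

LDS-ascRun-suc : ∀ a L → LDS (ascRun a (suc L)) ≡ 1
LDS-ascRun-suc a L =
  ≤-antisym (Dec.longest-antichain (AllPairs.map <⇒≯ (ascRun-increasing a (suc L))))
            (Dec.≤-longest {σ = ascRun a (suc L)} {s = suc a ∷ []} (refl ∷ minimum _) ([] ∷ []))

ascBlock-below : ∀ x → All (_≤ suc (length x)) (ascBlock 0 x)
ascBlock-below x = All.map proj₂ (inRange (AscBlocks.block-perm 0 x))

LIS-ascBlock : ∀ L {x} → Binary x → LIS (ascBlock L x) ≡ suc (R (replicate L 0 ++ x))
LIS-ascBlock L [] =
  trans (cong LIS (trans (ascStack≡ 0 L []) (++-identityʳ (ascRun 0 (suc L)))))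
        (trans (LIS-ascRun 0 (suc L)) (cong suc (sym (trans (cong R (++-identityʳ (replicate L 0))) (R-replicate L)))))
LIS-ascBlock L {0 ∷ x} (0∷ b) = trans (LIS-ascBlock (suc L) b) (cong (suc ∘ R) (sym (replicate-∷ L x)))
LIS-ascBlock L {1 ∷ x} (1∷ b) = begin
  LIS (ascBlock L (1 ∷ x))                    ≡⟨ cong LIS (ascStack≡ B L _) ⟩
  LIS (ascRun B (suc L) ++ ascBlock 0 x)
    ≡⟨ Inc.longest-++-unrelated (ascRun B (suc L)) _ (All.map (All.map <⇒≯) (ascRun-above (ascBlock-below x) (suc L))) ⟩
  LIS (ascRun B (suc L)) ⊔ LIS (ascBlock 0 x) ≡⟨ cong₂ _⊔_ (LIS-ascRun B (suc L)) (LIS-ascBlock 0 b) ⟩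
  suc (L ⊔ R x)                               ≡⟨ cong suc (sym (R-replicate-1∷ L x)) ⟩
  suc (R (replicate L 0 ++ 1 ∷ x))            ∎
  where
  open ≡-Reasoning
  B = suc (length x)

LDS-ascBlock : ∀ L {x} → Binary x → LDS (ascBlock L x) ≡ Bin+1 x
LDS-ascBlock L [] = trans (cong LDS (trans (ascStack≡ 0 L []) (++-identityʳ (ascRun 0 (suc L))))) (LDS-ascRun-suc 0 L)
LDS-ascBlock L (0∷ b) = LDS-ascBlock (suc L) b
LDS-ascBlock L {1 ∷ x} (1∷ b) =
  trans (cong LDS (ascStack≡ (suc (length x)) L _))
  (trans (Dec.longest-++-related (ascRun (suc (length x)) (suc L)) _ (ascRun-above (ascBlock-below x) (suc L)))
         (cong₂ _+_ (LDS-ascRun-suc (suc (length x)) L) (LDS-ascBlock 0 b)))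

LIS-132-213 : ∀ n → SameDist (Av (suc n) (p132 ∷ p213 ∷ [])) LIS (bits n) R+1
LIS-132-213 n = sameDist-Encoding LIS R+1 (Unique-bits n) (ascBlock-encoding n) (λ x∈ → LIS-ascBlock 0 (proj₁ (∈-bits⁻ n x∈)))

LDS-132-213 : ∀ n → SameDist (Av (suc n) (p132 ∷ p213 ∷ [])) LDS (bits n) Bin+1
LDS-132-213 n = sameDist-Encoding LDS Bin+1 (Unique-bits n) (ascBlock-encoding n) (λ x∈ → LDS-ascBlock 0 (proj₁ (∈-bits⁻ n x∈)))

-- (c) T = {132, 123}

Avoids-descStack : ∀ {b L ρ} → All (_≤ b) ρ → Avoids₂ p132 p123 ρ →
                   Avoids₂ p132 p123 (descRun b L ++ suc (b + L) ∷ ρ)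
Avoids-descStack {b} {L} {ρ} ρ≤b (avoid₁ , avoid₂) =
  (λ (x , y , z , sub , x<y , x<z , z≤y) → avoid₁ (x , y , z , inside sub x<y x<z , x<y , x<z , z≤y)) ,
  (λ (x , y , z , sub , x<y , x<z , y<z) → avoid₂ (x , y , z , inside sub x<y x<z , x<y , x<z , y<z))
  where
  below : ∀ {x y} → x ∈ descRun b L → y ∈ ρ → y < x
  below x∈ y∈ = ≤-<-trans (All.lookup ρ≤b y∈) (proj₁ (All.lookup (descRun-between b L) x∈))
  ρ<M : ∀ {y} → y ∈ ρ → y < suc (b + L)
  ρ<M y∈ = s≤s (≤-trans (All.lookup ρ≤b y∈) (m≤m+n b L))
  dec : ∀ {x y} → (x ∷ y ∷ []) ⊆ descRun b L → y < x
  dec sub = AllPairs-pair sub (descRun-decreasing b L)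
  -- Both patterns start with a rise x < y, x < z, which only ρ can provide.
  inside : ∀ {x y z} → (x ∷ y ∷ z ∷ []) ⊆ descRun b L ++ suc (b + L) ∷ ρ → x < y → x < z → (x ∷ y ∷ z ∷ []) ⊆ ρ
  inside sub x<y x<z with tripleView (descRun b L) sub
  ... | first sub′   = contradiction x<y (<⇒≯ (ρ<M (⊆-∈ sub′ (here refl))))
  ... | middle x∈ z∈ = contradiction x<z (<⇒≯ (below x∈ z∈))
  ... | last sub′    = contradiction x<y (<⇒≯ (dec sub′))
  ... | unused sub′ with tripleIn++ (descRun b L) sub′
  ...   | left sub″     = contradiction x<y (<⇒≯ (dec (⊆-trans (refl ∷ refl ∷ _ ∷ʳ []) sub″)))
  ...   | left₂ sub″ _  = contradiction x<y (<⇒≯ (dec sub″))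
  ...   | left₁ x∈ sub″ = contradiction x<y (<⇒≯ (below x∈ (⊆-∈ sub″ (here refl))))
  ...   | right sub″    = sub″

-- Left of the maximum, a rise x < y would form 123 with the maximum.
avoider-shape-132-123 : ∀ {n α β} → IsPerm n (α ++ β) → Avoids₂ p132 p123 (α ++ suc n ∷ β) → AllPairs _>_ α × Above α β
avoider-shape-132-123 {n} {α} {β} perm (avoid₁ , avoid₂) = pairs⇒AllPairs α descent , Avoids-132⇒Above perm avoid₁
  where
  below = All.++⁻ˡ α (below-max perm)
  descent : ∀ {x y} → (x ∷ y ∷ []) ⊆ α → y < x
  descent {x} {y} sub with x <? y
  ... | yes x<y = contradiction (x , y , suc n , Sublist.++⁺ sub (refl ∷ minimum β) , x<y ,
                                 All.lookup below (⊆-∈ sub (here refl)) , All.lookup below (⊆-∈ sub (there (here refl))))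
                                avoid₂
  ... | no x≮y = ≤∧≢⇒< (≮⇒≥ x≮y) λ y≡x → AllPairs-pair sub (AllPairs-resp-⊇ (Sublist.++⁺ʳ β ⊆-refl) (unique perm)) (sym y≡x)

module DescBlocks = MaxAfterRun descRun _>_ length-descRun descRun-between descRun-decreasing >⇒≢ descending⇒descRun
open DescBlocks using () renaming (block to descBlock)

descBlock-encoding : ∀ n → Encoding (suc n) p132 p123 (bits n) (descBlock 0)
descBlock-encoding n =
  bitsEncoding n (λ x → DescBlocks.block-perm 0 x , block-avoids 0 x) (block-complete n)
                 (λ bx by len eq → DescBlocks.block-injective bx by len eq)
  where open DescBlocks.Avoiders p132 p123 Avoids-descStack avoider-shape-132-123

startsWithZero : List ℕ → ℕ
startsWithZero (zero ∷ _) = 1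
startsWithZero _ = 0

-- T_n evaluated on x = (X₁, …, X_{n-1}), computed digit by digit from X₁ on.
Tᵣ : List ℕ → ℕ
Tᵣ [] = 1
Tᵣ (zero ∷ x) = Tᵣ x + startsWithZero x
Tᵣ (suc _ ∷ x) = suc (Tᵣ x)

Tᵣ-zeros : ∀ L → Tᵣ (replicate L 0) ≡ L ⊔ 1
Tᵣ-zeros zero = refl
Tᵣ-zeros (suc zero) = refl
Tᵣ-zeros (suc (suc L)) =
  trans (cong (_+ 1) (trans (Tᵣ-zeros (suc L)) (cong suc (⊔-identityʳ L)))) (+-comm (suc L) 1)

Tᵣ-zeros-1∷ : ∀ L x → Tᵣ (replicate L 0 ++ 1 ∷ x) ≡ (L ⊔ 1) + Tᵣ x
Tᵣ-zeros-1∷ zero x = refl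
Tᵣ-zeros-1∷ (suc zero) x = +-identityʳ _
Tᵣ-zeros-1∷ (suc (suc L)) x =
  trans (cong (_+ 1) (trans (Tᵣ-zeros-1∷ (suc L) x) (cong (λ k → suc k + Tᵣ x) (⊔-identityʳ L))))
        (+-comm (suc L + Tᵣ x) 1)

descStack≡ : ∀ b L ρ → descRun b L ++ suc (b + L) ∷ ρ ≡ (descRun b L ++ suc (b + L) ∷ []) ++ ρ
descStack≡ b L ρ = sym (++-assoc (descRun b L) _ ρ)

LDS-descRun-max : ∀ b L → LDS (descRun b L ++ suc (b + L) ∷ []) ≡ L ⊔ 1
LDS-descRun-max b L =
  trans (Dec.longest-++-unrelated (descRun b L) (_ ∷ [])
          (All.map (λ (_ , d≤) → <⇒≯ (s≤s d≤) ∷ []) (descRun-between b L)))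
        (cong₂ _⊔_ (LDS-descRun b L) (Dec.longest-[x] (suc (b + L))))

LDS-descBlock : ∀ L {x} → Binary x → LDS (descBlock L x) ≡ Tᵣ (replicate L 0 ++ x)
LDS-descBlock L [] = trans (LDS-descRun-max 0 L) (sym (trans (cong Tᵣ (++-identityʳ (replicate L 0))) (Tᵣ-zeros L)))
LDS-descBlock L {0 ∷ x} (0∷ b) = trans (LDS-descBlock (suc L) b) (cong Tᵣ (sym (replicate-∷ L x)))
LDS-descBlock L {1 ∷ x} (1∷ b) = begin
  LDS (descBlock L (1 ∷ x))                                 ≡⟨ cong LDS (descStack≡ B L _) ⟩
  LDS ((descRun B L ++ suc (B + L) ∷ []) ++ descBlock 0 x)  ≡⟨ Dec.longest-++-related _ _ above ⟩
  LDS (descRun B L ++ suc (B + L) ∷ []) + LDS (descBlock 0 x) ≡⟨ cong₂ _+_ (LDS-descRun-max B L) (LDS-descBlock 0 b) ⟩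
  (L ⊔ 1) + Tᵣ x                                            ≡⟨ sym (Tᵣ-zeros-1∷ L x) ⟩
  Tᵣ (replicate L 0 ++ 1 ∷ x)                               ∎
  where
  open ≡-Reasoning
  B = suc (length x)
  ρ≤B : All (_≤ B) (descBlock 0 x)
  ρ≤B = All.map proj₂ (inRange (DescBlocks.block-perm 0 x))
  above : Above (descRun B L ++ suc (B + L) ∷ []) (descBlock 0 x)
  above = All.++⁺ (All.map (λ (B<d , _) → All.map (λ c≤B → ≤-<-trans c≤B B<d) ρ≤B) (descRun-between B L))
                  (All.map (λ c≤B → s≤s (≤-trans c≤B (m≤m+n B L))) ρ≤B ∷ [])

map-applyUpTo : ∀ (f g : ℕ → ℕ) m → map f (applyUpTo g m) ≡ applyUpTo (f ∘ g) m
map-applyUpTo f g zero = refl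
map-applyUpTo f g (suc m) = cong (f (g 0) ∷_) (map-applyUpTo f (g ∘ suc) m)

sum-fromTo-2 : ∀ (f : ℕ → ℕ) k → sum (map f (fromTo 2 k)) ≡ sum (applyUpTo (λ j → f (2 + j)) (k ∸ 1))
sum-fromTo-2 f k = cong sum (trans (cong (map f) (map-applyUpTo (2 +_) (λ j → j) (k ∸ 1))) (map-applyUpTo f (2 +_) (k ∸ 1)))

-- The two sums in T_n, for m = n - 1:  Σ_{i=2}^{m-1} X_i  and  Σ_{i=2}^{m} X_i X_{i-1}.
ΣX : ℕ → List ℕ → ℕ
ΣX m x = sum (map (X x) (fromTo 2 (m ∸ 1)))

ΣXX : ℕ → List ℕ → ℕ
ΣXX m x = sum (map (λ i → X x i * X x (i ∸ 1)) (fromTo 2 m))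

ΣX-∷ : ∀ k b x → ΣX (3 + k) (b ∷ x) ≡ X x 1 + ΣX (2 + k) x
ΣX-∷ k b x = trans (sum-fromTo-2 (X (b ∷ x)) (2 + k)) (cong (X x 1 +_) (sym (sum-fromTo-2 (X x) (1 + k))))

ΣXX-∷ : ∀ k b x → ΣXX (3 + k) (b ∷ x) ≡ X x 1 * b + ΣXX (2 + k) x
ΣXX-∷ k b x = trans (sum-fromTo-2 (λ i → X (b ∷ x) i * X (b ∷ x) (i ∸ 1)) (3 + k))
                   (cong (X x 1 * b +_) (sym (sum-fromTo-2 (λ i → X x i * X x (i ∸ 1)) (2 + k))))

Tᵣ-sums : ∀ k {x} → Binary x → length x ≡ 2 + k → (2 + k) + ΣXX (2 + k) x ≡ Tᵣ x + ΣX (2 + k) x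
Tᵣ-sums zero (0∷ 0∷ []) _ = refl
Tᵣ-sums zero (0∷ 1∷ []) _ = refl
Tᵣ-sums zero (1∷ 0∷ []) _ = refl
Tᵣ-sums zero (1∷ 1∷ []) _ = refl
Tᵣ-sums (suc k) {0 ∷ x} (0∷ b) len = begin
  3 + k + ΣXX (3 + k) (0 ∷ x)               ≡⟨ cong (3 + k +_) (trans (ΣXX-∷ k 0 x) (cong (_+ ΣXX (2 + k) x) (*-zeroʳ (X x 1)))) ⟩
  suc (2 + k + ΣXX (2 + k) x)               ≡⟨ cong suc (Tᵣ-sums k b (suc-injective len)) ⟩
  suc (Tᵣ x + ΣX (2 + k) x)                 ≡⟨ sym (+-suc (Tᵣ x) _) ⟩
  Tᵣ x + (1 + ΣX (2 + k) x)                 ≡⟨ cong (λ t → Tᵣ x + (t + ΣX (2 + k) x)) (sym (startsWithZero+X₁ b (suc-injective len))) ⟩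
  Tᵣ x + ((startsWithZero x + X x 1) + ΣX (2 + k) x) ≡⟨ cong (Tᵣ x +_) (+-assoc (startsWithZero x) _ _) ⟩
  Tᵣ x + (startsWithZero x + (X x 1 + ΣX (2 + k) x)) ≡⟨ sym (+-assoc (Tᵣ x) _ _) ⟩
  Tᵣ x + startsWithZero x + (X x 1 + ΣX (2 + k) x) ≡⟨ cong (Tᵣ (0 ∷ x) +_) (sym (ΣX-∷ k 0 x)) ⟩
  Tᵣ (0 ∷ x) + ΣX (3 + k) (0 ∷ x)           ∎
  where
  open ≡-Reasoning
  startsWithZero+X₁ : ∀ {x} → Binary x → length x ≡ 2 + k → startsWithZero x + X x 1 ≡ 1
  startsWithZero+X₁ (0∷ _) _ = refl
  startsWithZero+X₁ (1∷ _) _ = refl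
Tᵣ-sums (suc k) {1 ∷ x} (1∷ b) len = begin
  3 + k + ΣXX (3 + k) (1 ∷ x)               ≡⟨ cong (3 + k +_) (trans (ΣXX-∷ k 1 x) (cong (_+ ΣXX (2 + k) x) (*-identityʳ (X x 1)))) ⟩
  suc (2 + k + (X x 1 + ΣXX (2 + k) x))     ≡⟨ cong suc (+-left-comm (2 + k) (X x 1) _) ⟩
  suc (X x 1 + (2 + k + ΣXX (2 + k) x))     ≡⟨ cong (λ t → suc (X x 1 + t)) (Tᵣ-sums k b (suc-injective len)) ⟩
  suc (X x 1 + (Tᵣ x + ΣX (2 + k) x))       ≡⟨ cong suc (+-left-comm (X x 1) (Tᵣ x) _) ⟩
  suc (Tᵣ x + (X x 1 + ΣX (2 + k) x))       ≡⟨ cong (Tᵣ (1 ∷ x) +_) (sym (ΣX-∷ k 1 x)) ⟩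
  Tᵣ (1 ∷ x) + ΣX (3 + k) (1 ∷ x)           ∎
  where open ≡-Reasoning

Tn≡Tᵣ : ∀ k {x} → Binary x → length x ≡ 2 + k → Tn (3 + k) x ≡ Tᵣ x
Tn≡Tᵣ k {x} b len = trans (cong (_∸ ΣX (2 + k) x) (Tᵣ-sums k b len)) (m+n∸n≡m (Tᵣ x) (ΣX (2 + k) x))

LDS-132-123 : ∀ k → SameDist (Av (3 + k) (p132 ∷ p123 ∷ [])) LDS (bits (2 + k)) (Tn (3 + k))
LDS-132-123 k = sameDist-Encoding LDS (Tn (3 + k)) (Unique-bits (2 + k)) (descBlock-encoding (2 + k)) LDS≡Tn
  where
  LDS≡Tn : ∀ {x} → x ∈ bits (2 + k) → LDS (descBlock 0 x) ≡ Tn (3 + k) x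
  LDS≡Tn x∈ with ∈-bits⁻ (2 + k) x∈
  ... | b , len = trans (LDS-descBlock 0 b) (sym (Tn≡Tᵣ k b len))

LIS≤2-132-123 : ∀ n σ → σ ∈ Av n (p132 ∷ p123 ∷ []) → LIS σ ≤ 2
LIS≤2-132-123 n σ σ∈ = LIS≤2 (proj₂ (proj₂ (∈-Av⁻ {1} {3} {2} {1} {2} {3} n σ∈)))

-- (a) T = {132, 321}

threeRuns : ℕ → ℕ × ℕ → List ℕ
threeRuns n (k , m) = ascRun k (m ∸ k) ++ ascRun 0 k ++ ascRun m (n ∸ m)

Dpairs : ℕ → List (ℕ × ℕ)
Dpairs n = concatMap (λ m → map (λ k → (k , m)) (fromTo 1 (m ∸ 1))) (fromTo 2 n)

∈-Dpairs⁻ : ∀ n {p} → p ∈ Dpairs n → ∃₂ λ k m → p ≡ (k , m) × 1 ≤ k × k < m × m ≤ n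
∈-Dpairs⁻ n p∈ with find (∈-concatMap⁻ (λ m → map (λ k → (k , m)) (fromTo 1 (m ∸ 1))) {xs = fromTo 2 n} p∈)
... | m , m∈ , p∈′ with ∈-map⁻ (λ k → (k , m)) p∈′ | ∈-fromTo⁻ 2 n m∈
...   | k , k∈ , refl | s≤s (s≤s _) , m≤n with ∈-fromTo⁻ 1 (m ∸ 1) k∈
...     | 1≤k , k≤m-1 = k , m , refl , 1≤k , s≤s k≤m-1 , m≤n

∈-Dpairs⁺ : ∀ n {k m} → 1 ≤ k → k < m → m ≤ n → (k , m) ∈ Dpairs n
∈-Dpairs⁺ n {k} {suc m} 1≤k (s≤s k≤m) m≤n =
  ∈-concatMap⁺ (λ m → map (λ k → (k , m)) (fromTo 1 (m ∸ 1)))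
    (lose (∈-fromTo⁺ 2 n (s≤s (≤-trans 1≤k k≤m)) m≤n) (∈-map⁺ (λ k → (k , suc m)) (∈-fromTo⁺ 1 m 1≤k k≤m)))

Unique-Dspace : ∀ n → Unique (Dspace n)
Unique-Dspace n = All.tabulate origin∉ ∷ Unique.concat⁺ (All.map⁺ (All.tabulate λ _ → column-unique)) columns-disjoint
  where
  origin∉ : ∀ {p} → p ∈ Dpairs n → (0 , 0) ≢ p
  origin∉ p∈ refl with ∈-Dpairs⁻ n p∈
  ... | _ , _ , refl , () , _
  column-unique : ∀ {m} → Unique (map (λ k → (k , m)) (fromTo 1 (m ∸ 1)))
  column-unique = Unique.map⁺ (cong proj₁) (Unique-fromTo 1 _)
  columns-disjoint : AllPairs Disjoint (map (λ m → map (λ k → (k , m)) (fromTo 1 (m ∸ 1))) (fromTo 2 n))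
  columns-disjoint = AllPairs.map⁺ (AllPairs.map different (Unique-fromTo 2 n))
    where
    different : ∀ {m m′} → m ≢ m′ → Disjoint (map (λ k → (k , m)) (fromTo 1 (m ∸ 1))) (map (λ k → (k , m′)) (fromTo 1 (m′ ∸ 1)))
    different m≢m′ (p∈ , p∈′) with ∈-map⁻ _ p∈ | ∈-map⁻ _ p∈′
    ... | _ , _ , refl | _ , _ , eq = m≢m′ (cong proj₂ eq)

Dspace-bounds : ∀ n {k m} → (k , m) ∈ Dspace n → k ≤ m × m ≤ n
Dspace-bounds n (here refl) = z≤n , z≤n
Dspace-bounds n (there p∈) with ∈-Dpairs⁻ n p∈
... | _ , _ , refl , _ , k<m , m≤n = <⇒≤ k<m , m≤n

data DView (n : ℕ) : ℕ × ℕ → Set where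
  old : ∀ {p} → p ∈ Dspace n → DView n p
  new : ∀ {j} → 1 ≤ j → j ≤ n → DView n (j , suc n)

dview : ∀ n {p} → p ∈ Dspace (suc n) → DView n p
dview n (here refl) = old (here refl)
dview n (there p∈) with ∈-Dpairs⁻ (suc n) p∈
... | k , m , refl , 1≤k , k<m , m≤1+n with m ≤? n
...   | yes m≤n = old (there (∈-Dpairs⁺ n 1≤k k<m m≤n))
...   | no m≰n with ≤-antisym m≤1+n (≰⇒> m≰n)
...     | refl = new 1≤k (≤-pred k<m)

Dspace-suc : ∀ n {p} → p ∈ Dspace n → p ∈ Dspace (suc n)
Dspace-suc n (here refl) = here refl
Dspace-suc n (there p∈) with ∈-Dpairs⁻ n p∈
... | _ , _ , refl , 1≤k , k<m , m≤n = there (∈-Dpairs⁺ (suc n) 1≤k k<m (m≤n⇒m≤1+n m≤n))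

threeRuns-old : ∀ n {k m} → (k , m) ∈ Dspace n → threeRuns (suc n) (k , m) ≡ threeRuns n (k , m) ++ suc n ∷ []
threeRuns-old n {k} {m} p∈ = begin
  ascRun k (m ∸ k) ++ ascRun 0 k ++ ascRun m (suc n ∸ m)           ≡⟨ cong (λ r → ascRun k (m ∸ k) ++ ascRun 0 k ++ r) grow ⟩
  ascRun k (m ∸ k) ++ ascRun 0 k ++ (ascRun m (n ∸ m) ++ suc n ∷ []) ≡⟨ cong (ascRun k (m ∸ k) ++_) (sym (++-assoc (ascRun 0 k) _ _)) ⟩
  ascRun k (m ∸ k) ++ (ascRun 0 k ++ ascRun m (n ∸ m)) ++ suc n ∷ [] ≡⟨ sym (++-assoc (ascRun k (m ∸ k)) _ _) ⟩
  threeRuns n (k , m) ++ suc n ∷ []                                   ∎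
  where
  open ≡-Reasoning
  m≤n = proj₂ (Dspace-bounds n p∈)
  grow : ascRun m (suc n ∸ m) ≡ ascRun m (n ∸ m) ++ suc n ∷ []
  grow = trans (cong (ascRun m) (+-∸-assoc 1 m≤n))
               (trans (ascRun-suc m (n ∸ m)) (cong (λ t → ascRun m (n ∸ m) ++ suc t ∷ []) (m+[n∸m]≡n m≤n)))

threeRuns-new : ∀ n {j} → j ≤ n → threeRuns (suc n) (j , suc n) ≡ ascRun j (n ∸ j) ++ suc n ∷ ascRun 0 j
threeRuns-new n {j} j≤n = begin
  ascRun j (suc n ∸ j) ++ ascRun 0 j ++ ascRun (suc n) (n ∸ n) ≡⟨ cong (λ r → ascRun j (suc n ∸ j) ++ ascRun 0 j ++ ascRun (suc n) r) (n∸n≡0 n) ⟩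
  ascRun j (suc n ∸ j) ++ ascRun 0 j ++ []                     ≡⟨ cong (ascRun j (suc n ∸ j) ++_) (++-identityʳ (ascRun 0 j)) ⟩
  ascRun j (suc n ∸ j) ++ ascRun 0 j                           ≡⟨ cong (_++ ascRun 0 j) grow ⟩
  (ascRun j (n ∸ j) ++ suc n ∷ []) ++ ascRun 0 j               ≡⟨ ++-assoc (ascRun j (n ∸ j)) _ _ ⟩
  ascRun j (n ∸ j) ++ suc n ∷ ascRun 0 j                       ∎
  where
  open ≡-Reasoning
  grow : ascRun j (suc n ∸ j) ≡ ascRun j (n ∸ j) ++ suc n ∷ []
  grow = trans (cong (ascRun j) (+-∸-assoc 1 j≤n))
                (trans (ascRun-suc j (n ∸ j)) (cong (λ t → ascRun j (n ∸ j) ++ suc t ∷ []) (m+[n∸m]≡n j≤n)))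

Avoids-twoRuns : ∀ {n α β} → AllPairs _<_ α → AllPairs _<_ β → Above α β → All (_< suc n) (α ++ β) →
                 Avoids₂ p132 p321 (α ++ suc n ∷ β)
Avoids-twoRuns {n} {α} {β} incα incβ above below = no132 , no321
  where
  <M : ∀ {x} → x ∈ α ++ β → x < suc n
  <M = All.lookup below
  no132 : Avoids p132 (α ++ suc n ∷ β)
  no132 (x , y , z , sub , x<y , x<z , z≤y) with tripleView α sub
  ... | first sub′   = <-asym x<y (<M (∈-++⁺ʳ α (⊆-∈ sub′ (here refl))))
  ... | middle x∈ z∈ = <-asym x<z (All.lookup (All.lookup above x∈) z∈)
  ... | last sub′    = <⇒≱ (<M (∈-++⁺ˡ (⊆-∈ sub′ (there (here refl))))) z≤y
  ... | unused sub′ with tripleIn++ α sub′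
  ...   | left sub″     = <⇒≱ (AllPairs-pair (⊆-trans (_ ∷ʳ ⊆-refl) sub″) incα) z≤y
  ...   | left₂ sub″ z∈ = <-asym x<z (All.lookup (All.lookup above (⊆-∈ sub″ (here refl))) z∈)
  ...   | left₁ x∈ sub″ = <-asym x<y (All.lookup (All.lookup above x∈) (⊆-∈ sub″ (here refl)))
  ...   | right sub″    = <⇒≱ (AllPairs-pair (⊆-trans (_ ∷ʳ ⊆-refl) sub″) incβ) z≤y
  no321 : Avoids p321 (α ++ suc n ∷ β)
  no321 (x , y , z , sub , y≤x , z≤x , z≤y) with tripleView α sub
  ... | first sub′   = <⇒≱ (AllPairs-pair sub′ incβ) z≤y
  ... | middle x∈ _  = <⇒≱ (<M (∈-++⁺ˡ x∈)) y≤x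
  ... | last sub′    = <⇒≱ (<M (∈-++⁺ˡ (⊆-∈ sub′ (here refl)))) z≤x
  ... | unused sub′ with tripleIn++ α sub′
  ...   | left sub″     = <⇒≱ (AllPairs-pair (⊆-trans (refl ∷ refl ∷ _ ∷ʳ []) sub″) incα) y≤x
  ...   | left₂ sub″ _  = <⇒≱ (AllPairs-pair sub″ incα) y≤x
  ...   | left₁ _ sub″  = <⇒≱ (AllPairs-pair sub″ incβ) z≤y
  ...   | right sub″    = <⇒≱ (AllPairs-pair (⊆-trans (_ ∷ʳ ⊆-refl) sub″) incβ) z≤y

twoRuns-sound : ∀ n {j} → j ≤ n → IsPerm (suc n) (ascRun j (n ∸ j) ++ suc n ∷ ascRun 0 j) ×
                                  Avoids₂ p132 p321 (ascRun j (n ∸ j) ++ suc n ∷ ascRun 0 j)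
twoRuns-sound n {j} j≤n =
  perm , Avoids-twoRuns (ascRun-increasing j _) (ascRun-increasing 0 j) (ascRun-above (All.map proj₂ (ascRun-between 0 j)) _)
                        (below-max perm′)
  where
  perm′ : IsPerm n (ascRun j (n ∸ j) ++ ascRun 0 j)
  perm′ = subst (λ k → IsPerm k (ascRun j (n ∸ j) ++ ascRun 0 j)) (m+[n∸m]≡n j≤n)
            (IsPerm-stack (IsPerm-ascRun j) (length-ascRun j _) (ascRun-between j _) (AllPairs.map <⇒≢ (ascRun-increasing j _)))
  perm = IsPerm-insert-max (ascRun j (n ∸ j)) perm′

threeRuns-sound : ∀ n {p} → p ∈ Dspace n → IsPerm n (threeRuns n p) × Avoids₂ p132 p321 (threeRuns n p)
threeRuns-sound zero (here refl) = isPerm refl [] [] , Avoids-[] {p132} , Avoids-[] {p321}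
threeRuns-sound (suc n) p∈ with dview n p∈
... | old {k , m} p∈′ with threeRuns-sound n p∈′
...   | perm , avoid₁ , avoid₂ =
  subst (λ σ → IsPerm (suc n) σ × Avoids₂ p132 p321 σ) (sym (threeRuns-old n p∈′))
    (IsPerm-insert-max (threeRuns n (k , m)) (subst (IsPerm n) (sym (++-identityʳ _)) perm) ,
     Avoids-∷ʳ {p132} avoid₁ (λ sub (_ , _ , M≤y) → <⇒≱ (All.lookup (below-max perm) (⊆-∈ sub (there (here refl)))) M≤y) ,
     Avoids-∷ʳ {p321} avoid₂ (λ sub (_ , M≤x , _) → <⇒≱ (All.lookup (below-max perm) (⊆-∈ sub (here refl))) M≤x))
threeRuns-sound (suc n) p∈ | new 1≤j j≤n =
  subst (λ σ → IsPerm (suc n) σ × Avoids₂ p132 p321 σ) (sym (threeRuns-new n j≤n)) (twoRuns-sound n j≤n)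

-- Right of the maximum, and then also left of it, a descent would complete a 321.
avoider-shape-132-321 : ∀ {n α c β} → IsPerm n (α ++ c ∷ β) → Avoids₂ p132 p321 (α ++ suc n ∷ c ∷ β) →
                        AllPairs _<_ α × AllPairs _<_ (c ∷ β) × Above α (c ∷ β)
avoider-shape-132-321 {n} {α} {c} {β} perm (avoid₁ , avoid₂) =
  pairs⇒AllPairs α ascentα , pairs⇒AllPairs (c ∷ β) ascentβ , above
  where
  above = Avoids-132⇒Above perm avoid₁
  below = below-max perm
  ascentα : ∀ {x y} → (x ∷ y ∷ []) ⊆ α → x < y
  ascentα {x} {y} sub with x <? y
  ... | yes x<y = x<y
  ... | no x≮y = contradiction (x , y , c , Sublist.++⁺ sub (_ ∷ʳ refl ∷ minimum β) , ≮⇒≥ x≮y ,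
                                <⇒≤ (All.head (All.lookup above (⊆-∈ sub (here refl)))) ,
                                <⇒≤ (All.head (All.lookup above (⊆-∈ sub (there (here refl))))))
                               avoid₂
  ascentβ : ∀ {y z} → (y ∷ z ∷ []) ⊆ c ∷ β → y < z
  ascentβ {y} {z} sub with y <? z
  ... | yes y<z = y<z
  ... | no y≮z = contradiction (suc n , y , z , Sublist.++⁺ˡ α (refl ∷ sub) ,
                                <⇒≤ (All.lookup below (∈-++⁺ʳ α (⊆-∈ sub (here refl)))) ,
                                <⇒≤ (All.lookup below (∈-++⁺ʳ α (⊆-∈ sub (there (here refl))))) , ≮⇒≥ y≮z)
                               avoid₂

threeRuns-complete : ∀ n {σ} → IsPerm n σ → Avoids₂ p132 p321 σ → ∃[ p ] (p ∈ Dspace n × σ ≡ threeRuns n p)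
threeRuns-complete zero {[]} _ _ = (0 , 0) , here refl , refl
threeRuns-complete zero {_ ∷ _} (isPerm () _ _) _
threeRuns-complete (suc n) perm (avoid₁ , avoid₂) with IsPerm-split-max perm
... | α , [] , refl , perm′
  with threeRuns-complete n (subst (IsPerm n) (++-identityʳ α) perm′)
                            (Avoids-anti {p132} (Sublist.++⁺ʳ _ ⊆-refl) avoid₁ , Avoids-anti {p321} (Sublist.++⁺ʳ _ ⊆-refl) avoid₂)
...   | (k , m) , p∈ , refl = (k , m) , Dspace-suc n p∈ , sym (threeRuns-old n p∈)
threeRuns-complete (suc n) perm (avoid₁ , avoid₂) | α , c ∷ β , refl , perm′
  with avoider-shape-132-321 perm′ (avoid₁ , avoid₂)
... | incα , incβ , above with IsPerm-above-split n α (c ∷ β) perm′ above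
...   | between , permβ =
  (j , suc n) , there (∈-Dpairs⁺ (suc n) (s≤s z≤n) (s≤s j≤n) ≤-refl) ,
  trans (cong₂ (λ γ δ → γ ++ suc n ∷ δ) α≡ β≡) (sym (threeRuns-new n j≤n))
  where
  j = length (c ∷ β)
  n≡ : length α + j ≡ n
  n≡ = trans (sym (length-++ α)) (length≡ perm′)
  j≤n : j ≤ n
  j≤n = subst (j ≤_) n≡ (m≤n+m j _)
  β≡ : c ∷ β ≡ ascRun 0 j
  β≡ = ascending⇒ascRun 0 (c ∷ β) incβ (inRange permβ)
  α≡ : α ≡ ascRun j (n ∸ j)
  α≡ = trans (ascending⇒ascRun j α incα (subst (λ k → All (Between j k) α) (trans (sym n≡) (+-comm _ j)) between))
             (cong (ascRun j) (trans (sym (m+n∸n≡m (length α) j)) (cong (_∸ j) n≡)))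

ascRun∌max : ∀ n {i} → i ≤ n → suc n ∉ ascRun i (n ∸ i)
ascRun∌max n {i} i≤n = ∉-below (All.map (λ (_ , x≤) → s≤s (subst (_ ≤_) (m+[n∸m]≡n i≤n) x≤)) (ascRun-between i (n ∸ i)))

threeRuns∌max : ∀ n {p} → p ∈ Dspace n → suc n ∉ threeRuns n p
threeRuns∌max n p∈ = ∉-below (below-max (proj₁ (threeRuns-sound n p∈)))

threeRuns-injective : ∀ n {p q} → p ∈ Dspace n → q ∈ Dspace n → threeRuns n p ≡ threeRuns n q → p ≡ q
threeRuns-injective zero (here refl) (here refl) _ = refl
threeRuns-injective (suc n) p∈ q∈ eq with dview n p∈ | dview n q∈
... | old {k , m} p∈′ | old {k′ , m′} q∈′ =
  threeRuns-injective n p∈′ q∈′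
    (∷ʳ-injectiveˡ _ _ (trans (sym (threeRuns-old n p∈′))
                              (trans eq (threeRuns-old n q∈′))))
... | new {j} _ j≤n | new {j′} _ j′≤n
  with ++-∷-unique (ascRun j (n ∸ j)) (ascRun∌max n j≤n) (ascRun∌max n j′≤n)
                   (trans (sym (threeRuns-new n j≤n)) (trans eq (threeRuns-new n j′≤n)))
...   | _ , runs≡ = cong (_, suc n) (trans (sym (length-ascRun 0 j)) (trans (cong length runs≡) (length-ascRun 0 j′)))
threeRuns-injective (suc n) p∈ q∈ eq | old {k , m} p∈′ | new {suc j} _ j≤n
  with ++-∷-unique (threeRuns n (k , m)) (threeRuns∌max n p∈′) (ascRun∌max n j≤n)
                   (trans (sym (threeRuns-old n p∈′)) (trans eq (threeRuns-new n j≤n)))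
... | _ , ()
threeRuns-injective (suc n) p∈ q∈ eq | new {suc j} _ j≤n | old {k , m} q∈′
  with ++-∷-unique (threeRuns n (k , m)) (threeRuns∌max n q∈′) (ascRun∌max n j≤n)
                   (trans (sym (threeRuns-old n q∈′)) (trans (sym eq) (threeRuns-new n j≤n)))
... | _ , ()

⊓+⊔ : ∀ a b → a ⊓ b + (a ⊔ b) ≡ a + b
⊓+⊔ a b with ≤-total a b
... | inj₁ a≤b = cong₂ _+_ (m≤n⇒m⊓n≡m a≤b) (m≤n⇒m⊔n≡n a≤b)
... | inj₂ b≤a = trans (cong₂ _+_ (m≥n⇒m⊓n≡n b≤a) (m≥n⇒m⊔n≡m b≤a)) (+-comm b a)

Dn≡ : ∀ n {k m} → k ≤ m → m ≤ n → Dn n (k , m) ≡ ((m ∸ k) ⊔ k) + (n ∸ m)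
Dn≡ n {k} {m} k≤m m≤n = begin
  n ∸ (a ⊓ k)                     ≡⟨ cong (_∸ (a ⊓ k)) n≡ ⟩
  (a ⊓ k + (a ⊔ k + c)) ∸ (a ⊓ k) ≡⟨ m+n∸m≡n (a ⊓ k) _ ⟩
  a ⊔ k + c                       ∎
  where
  open ≡-Reasoning
  a = m ∸ k
  c = n ∸ m
  n≡ : n ≡ a ⊓ k + (a ⊔ k + c)
  n≡ = sym (begin
    a ⊓ k + (a ⊔ k + c) ≡⟨ sym (+-assoc (a ⊓ k) _ c) ⟩
    (a ⊓ k + (a ⊔ k)) + c ≡⟨ cong (_+ c) (trans (⊓+⊔ a k) (m∸n+n≡m k≤m)) ⟩
    m + c               ≡⟨ m+[n∸m]≡n m≤n ⟩
    n                   ∎)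

LIS-threeRuns : ∀ n {k m} → k ≤ m → m ≤ n → LIS (threeRuns n (k , m)) ≡ Dn n (k , m)
LIS-threeRuns n {k} {m} k≤m m≤n = begin
  LIS (A ++ B ++ C)          ≡⟨ cong LIS (sym (++-assoc A B C)) ⟩
  LIS ((A ++ B) ++ C)        ≡⟨ Inc.longest-++-related (A ++ B) C (below-ascRun (n ∸ m) (All.++⁺ A≤m B≤m)) ⟩
  LIS (A ++ B) + LIS C       ≡⟨ cong (_+ LIS C) (Inc.longest-++-unrelated A B (All.map (All.map <⇒≯) (ascRun-above B≤k (m ∸ k)))) ⟩
  (LIS A ⊔ LIS B) + LIS C    ≡⟨ cong₂ _+_ (cong₂ _⊔_ (LIS-ascRun k (m ∸ k)) (LIS-ascRun 0 k)) (LIS-ascRun m (n ∸ m)) ⟩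
  ((m ∸ k) ⊔ k) + (n ∸ m)    ≡⟨ sym (Dn≡ n k≤m m≤n) ⟩
  Dn n (k , m)               ∎
  where
  open ≡-Reasoning
  A = ascRun k (m ∸ k)
  B = ascRun 0 k
  C = ascRun m (n ∸ m)
  B≤k : All (_≤ k) B
  B≤k = All.map proj₂ (ascRun-between 0 k)
  B≤m = All.map (λ x≤k → ≤-trans x≤k k≤m) B≤k
  A≤m : All (_≤ m) A
  A≤m = All.map (λ (_ , x≤) → subst (_ ≤_) (m+[n∸m]≡n k≤m) x≤) (ascRun-between k (m ∸ k))

threeRuns-encoding : ∀ n → Encoding n p132 p321 (Dspace n) (threeRuns n)
threeRuns-encoding n = record
  { sound = threeRuns-sound n ; complete = threeRuns-complete n ; injective = threeRuns-injective n }

LIS-132-321 : ∀ n → SameDist (Av n (p132 ∷ p321 ∷ [])) LIS (Dspace n) (Dn n)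
LIS-132-321 n = sameDist-Encoding LIS (Dn n) (Unique-Dspace n) (threeRuns-encoding n) LIS≡Dn
  where
  LIS≡Dn : ∀ {p} → p ∈ Dspace n → LIS (threeRuns n p) ≡ Dn n p
  LIS≡Dn {k , m} p∈ = LIS-threeRuns n (proj₁ (Dspace-bounds n p∈)) (proj₂ (Dspace-bounds n p∈))

LDS≤2-132-321 : ∀ n σ → σ ∈ Av n (p132 ∷ p321 ∷ []) → LDS σ ≤ 2
LDS≤2-132-321 n σ σ∈ = LDS≤2 (proj₂ (proj₂ (∈-Av⁻ {1} {3} {2} {3} {2} {1} n σ∈)))

theorem2p1 : ∀ (n : ℕ) → 3 ≤ n →
    (SameDist (Av n (p132 ∷ p321 ∷ [])) LIS (Dspace n) (Dn n)
      × (∀ σ → σ ∈ Av n (p132 ∷ p321 ∷ []) → LDS σ ≤ 2))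
    × (SameDist (Av n (p132 ∷ p231 ∷ [])) LIS (bits (n ∸ 1)) Bin+1
      × SameDist (Av n (p132 ∷ p231 ∷ [])) LDS (bits (n ∸ 1)) Bin+1)
    × (SameDist (Av n (p132 ∷ p123 ∷ [])) LDS (bits (n ∸ 1)) (Tn n)
      × (∀ σ → σ ∈ Av n (p132 ∷ p123 ∷ []) → LIS σ ≤ 2))
    × (SameDist (Av n (p132 ∷ p213 ∷ [])) LDS (bits (n ∸ 1)) Bin+1
      × SameDist (Av n (p132 ∷ p213 ∷ [])) LIS (bits (n ∸ 1)) R+1)
theorem2p1 n@(suc (suc (suc k))) (s≤s (s≤s (s≤s _))) =
  (LIS-132-321 n , LDS≤2-132-321 n) ,
  (LIS-132-231 (2 + k) , LDS-132-231 (2 + k)) ,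
  (LDS-132-123 k , LIS≤2-132-123 n) ,
  (LDS-132-213 (2 + k) , LIS-132-213 (2 + k))
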